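{- Let $a$ be an odd integer. For $t\ge 5$, $$\#\bar{D}_2(a;2^t)=\begin{cases}\frac{2^{t-4}}{3}+\frac{(-1)^{t-1}}{3}+3 & a\equiv 7 \bmod 8,\\ 2^{t-3} & a\equiv 1,5 \bmod 8,\\ 2^{t-4} & a\equiv 3\bmod 8,\end{cases}\qquad \#\bar{S}_2(a;2^t)=\begin{cases}\frac{2^{t-4}}{3}+\frac{(-1)^{t-1}}{3}+3 & a\equiv 1 \bmod 8,\\ 2^{t-3} & a\equiv 3,7 \bmod 8,\\ 2^{t-4} & a\equiv 5\bmod 8.\end{cases}$$ Moreover, $\#\bar{S}_2(a;16)=2$ for all odd $a$, and for $1\le t\le 3$ we have $\#\bar{S}_2(a;2^t)=1$, except that $\#\bar{S}_2(a;8)=2$ when $a\equiv 1\bmod 4$.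
   Context: For $n\ge2$ and $a$ coprime to $n$, $H_2(a;n)=\{(x,y)\in\mathbb{Z}^2: xy\equiv a \bmod n,\ 1\le x,y<n\}$, $\bar{S}_2(a;n)=\{x+y \bmod n:(x,y)\in H_2(a;n)\}$ and $\bar{D}_2(a;n)=\{x-y \bmod n:(x,y)\in H_2(a;n)\}$, both subsets of $\mathbb{Z}/n\mathbb{Z}$. -}

module Defs where

open import Data.Nat using (ℕ; _+_; _*_; _≤_; _<_)
open import Data.Integer as ℤ using (ℤ; +_)
open import Data.Integer.Divisibility using () renaming (_∣_ to _∣ℤ_)
open import Data.Fin using (Fin; toℕ)
open import Data.List using (List; length)
open import Data.List.Membership.Propositional using (_∈_)
open import Data.List.Relation.Unary.Unique.Propositional using (Unique)
open import Data.Product using (Σ; ∃; _×_)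
open import Relation.Binary.PropositionalEquality using (_≡_)

_≡_[mod_] : ℤ → ℤ → ℕ → Set
x ≡ y [mod n ] = (+ n) ∣ℤ (x ℤ.- y)

H₂ : ℤ → (n : ℕ) → ℕ → ℕ → Set
H₂ a n x y = (1 ≤ x × x < n) × (1 ≤ y × y < n) × ((+ (x * y)) ≡ a [mod n ])

-- Elements of ℤ/nℤ are represented by their canonical residues r ∈ Fin n.
-- r ∈ S̄₂(a; n)
InS̄₂ : ℤ → (n : ℕ) → Fin n → Set
InS̄₂ a n r = ∃ λ x → ∃ λ y → H₂ a n x y × ((+ (x + y)) ≡ (+ toℕ r) [mod n ])

InD̄₂ : ℤ → (n : ℕ) → Fin n → Set
InD̄₂ a n r = ∃ λ x → ∃ λ y → H₂ a n x y × (((+ x) ℤ.- (+ y)) ≡ (+ toℕ r) [mod n ])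

HasCard : {n : ℕ} → (Fin n → Set) → ℕ → Set
HasCard {n} P k = Σ (List (Fin n)) λ l →
  Unique l × ((r : Fin n) → (r ∈ l → P r) × (P r → r ∈ l)) × length l ≡ k

{-# OPTIONS --safe #-}

-- Writing x - y = 2e, the congruence x y ≡ a (mod 2m) becomes (y + e)² ≡ a + e², while x - y is never
-- odd because a is odd.  So #D̄₂(a; 2m) is the number of e < m for which a + e² is a square mod 2m, and
-- #S̄₂(a; 2m) is the same count for -a (replace y by -y).  Modulo 2ᵗ, t ≥ 5, a number not divisible by 8
-- is a square iff it is ≡ 1 mod 8 or ≡ 4 mod 32.  If c ≢ 7 mod 8, then c + e² is never ≡ 0 mod 8 and the
-- count is 2ᵗ⁻⁵ times a count over e < 16 depending only on c mod 32.  If c ≡ 7 mod 8, then c ≡ -b² for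
-- an odd b (Hensel); only the odd e = 2w + b contribute, with c + e² ≡ 4 w (w + b), and counting the w
-- for which w (w + b) is a square gives 2 φ(t - 4), where φ(T + 2) = φ(T) + ⌈2ᵀ⁻¹⌉ has the closed form
-- of the statement.  The small moduli are finite computations.

module Submission where

open import Defs

open import Data.Bool.Base using (if_then_else_)
open import Data.Empty using (⊥-elim)
open import Data.Fin.Base using (Fin; toℕ; fromℕ<) renaming (zero to fzero; suc to fsuc)
open import Data.Fin.Properties using (toℕ<n; toℕ-fromℕ<; all?; any?)
open import Data.List.Base using (length; filter; tabulate; allFin)
open import Data.List.Properties using (filter-accept; filter-reject)
open import Data.List.Membership.Propositional.Properties using (∈-filter⁺; ∈-filter⁻; ∈-allFin)
open import Data.List.Relation.Unary.Unique.Propositional.Properties using (filter⁺; allFin⁺)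
open import Data.Integer.Base as ℤ using (ℤ; +_; -_; ∣_∣)
open import Data.Integer.DivMod using (_%ℕ_; _/ℕ_; n%ℕd<d; a≡a%ℕn+[a/ℕn]*n)
import Data.Integer.Divisibility.Signed as Signed
open Signed using (∣⇒∣ᵤ; ∣ᵤ⇒∣)
open import Data.Integer.Properties
  using (pos-*; pos-+; +-comm; +-identityˡ; +-inverseʳ; *-comm; *-assoc; *-zeroˡ; neg-involutive; *-cancelˡ-≡)
open import Data.Integer.Tactic.RingSolver using (solve-∀)
open import Data.Nat.Base as ℕ using (ℕ; zero; suc; _<_; _≤_; z≤n; s≤s; _^_; _∸_; NonZero)
open import Data.Nat.Divisibility using (_∣_; divides; _∣?_; ∣-trans; m∣m*n)
import Data.Nat.Properties as ℕₚ
import Data.Sum as Sum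
open Sum using (_⊎_; inj₁; inj₂)
open import Data.Product using (∃; _×_; _,_; proj₁; proj₂)
open import Function.Base using (_∘_; id)
open import Function.Bundles using (_⇔_; mk⇔; Equivalence)
open import Function.Construct.Symmetry using (⇔-sym)
open import Function.Construct.Composition using (_⇔-∘_)
open import Relation.Binary.PropositionalEquality
  using (_≡_; refl; sym; trans; cong; cong₂; subst; module ≡-Reasoning)
open import Relation.Nullary using (Dec; yes; no; does; ¬_)
open import Relation.Nullary.Decidable
  using (does-⇔; dec-true; dec-false; map; map′; from-yes; from-no; _→-dec_; _⊎-dec_)
open import Relation.Unary using (Pred; Decidable)

module Counting where

  open import Data.Nat.Base using (_+_; _*_)
  open import Algebra.Properties.CommutativeSemigroup ℕₚ.+-commutativeSemigroup
    using () renaming (interchange to +-interchange)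

  indicator : {A : Set} → Dec A → ℕ
  indicator a? = if does a? then 1 else 0

  indicator-⇔ : {A B : Set} → A ⇔ B → (a? : Dec A) (b? : Dec B) → indicator a? ≡ indicator b?
  indicator-⇔ A⇔B a? b? = cong (λ b → if b then 1 else 0) (does-⇔ A⇔B a? b?)

  count : ℕ → {P : Pred ℕ _} → Decidable P → ℕ
  count zero    P? = 0
  count (suc n) P? = indicator (P? 0) + count n (λ x → P? (suc x))

  count-cong : ∀ n {P Q : Pred ℕ _} (P? : Decidable P) (Q? : Decidable Q) →
               (∀ x → x < n → P x ⇔ Q x) → count n P? ≡ count n Q?
  count-cong zero    P? Q? eq = refl
  count-cong (suc n) P? Q? eq = cong₂ _+_ (indicator-⇔ (eq 0 (s≤s z≤n)) (P? 0) (Q? 0))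
    (count-cong n (λ x → P? (suc x)) (λ x → Q? (suc x)) (λ x x<n → eq (suc x) (s≤s x<n)))

  count-reindex : ∀ n {P : Pred ℕ _} (P? : Decidable P) {f g : ℕ → ℕ} → (∀ x → f x ≡ g x) →
                  count n (λ x → P? (f x)) ≡ count n (λ x → P? (g x))
  count-reindex zero    P? eq = refl
  count-reindex (suc n) P? eq =
    cong₂ _+_ (cong (λ y → indicator (P? y)) (eq 0)) (count-reindex n P? (λ x → eq (suc x)))

  count-none : ∀ n {P : Pred ℕ _} (P? : Decidable P) → (∀ x → ¬ P x) → count n P? ≡ 0
  count-none zero    P? ¬P = refl
  count-none (suc n) P? ¬P rewrite dec-false (P? 0) (¬P 0) = count-none n (λ x → P? (suc x)) (λ x → ¬P (suc x))

  count-all : ∀ n {P : Pred ℕ _} (P? : Decidable P) → (∀ x → P x) → count n P? ≡ n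
  count-all zero    P? all = refl
  count-all (suc n) P? all rewrite dec-true (P? 0) (all 0) = cong suc (count-all n (λ x → P? (suc x)) (all ∘ suc))

  count-+ : ∀ m n {P : Pred ℕ _} (P? : Decidable P) →
            count (m + n) P? ≡ count m P? + count n (λ x → P? (m + x))
  count-+ zero    n P? = refl
  count-+ (suc m) n P? = trans (cong (λ k → indicator (P? 0) + k) (count-+ m n (λ x → P? (suc x))))
    (sym (ℕₚ.+-assoc (indicator (P? 0)) _ _))

  count-suc : ∀ n {P : Pred ℕ _} (P? : Decidable P) → count (suc n) P? ≡ count n P? + indicator (P? n)
  count-suc n P? = begin
    count (suc n) P?                          ≡⟨ cong (λ k → count k P?) (ℕₚ.+-comm 1 n) ⟩
    count (n + 1) P?                          ≡⟨ count-+ n 1 P? ⟩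
    count n P? + (indicator (P? (n + 0)) + 0) ≡⟨ cong (λ k → count n P? + k) (ℕₚ.+-identityʳ _) ⟩
    count n P? + indicator (P? (n + 0))       ≡⟨ cong (λ k → count n P? + indicator (P? k)) (ℕₚ.+-identityʳ n) ⟩
    count n P? + indicator (P? n)             ∎
    where open ≡-Reasoning

  count-evens-odds : ∀ n {P : Pred ℕ _} (P? : Decidable P) →
    count (2 * n) P? ≡ count n (λ x → P? (2 * x)) + count n (λ x → P? (suc (2 * x)))
  count-evens-odds zero    P? = refl
  count-evens-odds (suc n) P? = begin
    count (2 * suc n) P?
      ≡⟨ cong (λ k → count k P?) (ℕₚ.*-suc 2 n) ⟩
    i₀ + (i₁ + count (2 * n) (λ x → P? (2 + x)))
      ≡⟨ cong (λ k → i₀ + (i₁ + k)) (count-evens-odds n (λ x → P? (2 + x))) ⟩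
    i₀ + (i₁ + (count n (λ x → P? (2 + 2 * x)) + count n (λ x → P? (3 + 2 * x))))
      ≡⟨ cong₂ (λ u v → i₀ + (i₁ + (u + v)))
           (count-reindex n P? (λ x → sym (ℕₚ.*-suc 2 x)))
           (count-reindex n P? (λ x → cong suc (sym (ℕₚ.*-suc 2 x)))) ⟩
    i₀ + (i₁ + (count n (λ x → P? (2 * suc x)) + count n (λ x → P? (suc (2 * suc x)))))
      ≡⟨ ℕₚ.+-assoc i₀ i₁ _ ⟨
    (i₀ + i₁) + (count n (λ x → P? (2 * suc x)) + count n (λ x → P? (suc (2 * suc x))))
      ≡⟨ +-interchange i₀ i₁ _ _ ⟩
    (i₀ + count n (λ x → P? (2 * suc x))) + (i₁ + count n (λ x → P? (suc (2 * suc x))))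
      ∎
    where
    open ≡-Reasoning
    i₀ = indicator (P? 0)
    i₁ = indicator (P? 1)

  count-periodic : ∀ M k {P : Pred ℕ _} (P? : Decidable P) → (∀ x → P (x + k) ⇔ P x) →
                   count (M * k) P? ≡ M * count k P?
  count-periodic zero    k P? per = refl
  count-periodic (suc M) k P? per = begin
    count (k + M * k) P?
      ≡⟨ count-+ k (M * k) P? ⟩
    count k P? + count (M * k) (λ x → P? (k + x))
      ≡⟨ cong (λ c → count k P? + c) (count-reindex (M * k) P? (λ x → ℕₚ.+-comm k x)) ⟩
    count k P? + count (M * k) (λ x → P? (x + k))
      ≡⟨ cong (λ c → count k P? + c) (count-cong (M * k) _ P? (λ x _ → per x)) ⟩
    count k P? + count (M * k) P?
      ≡⟨ cong (λ c → count k P? + c) (count-periodic M k P? per) ⟩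
    count k P? + M * count k P? ∎
    where open ≡-Reasoning

  private
    count-rotate₁ : ∀ n {P : Pred ℕ _} (P? : Decidable P) → P n ⇔ P 0 →
                    count n (λ x → P? (suc x)) ≡ count n P?
    count-rotate₁ n P? Pn⇔P0 = ℕₚ.+-cancelʳ-≡ (indicator (P? 0)) _ _ (begin
      count n (λ x → P? (suc x)) + indicator (P? 0)
        ≡⟨ ℕₚ.+-comm _ (indicator (P? 0)) ⟩
      count (suc n) P?
        ≡⟨ count-suc n P? ⟩
      count n P? + indicator (P? n)
        ≡⟨ cong (λ c → count n P? + c) (indicator-⇔ Pn⇔P0 (P? n) (P? 0)) ⟩
      count n P? + indicator (P? 0) ∎)
      where open ≡-Reasoning

  count-rotate : ∀ n s {P : Pred ℕ _} (P? : Decidable P) → (∀ x → P (x + n) ⇔ P x) →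
                 count n (λ x → P? (x + s)) ≡ count n P?
  count-rotate n zero    P? per = count-reindex n P? ℕₚ.+-identityʳ
  count-rotate n (suc s) {P} P? per = begin
    count n (λ x → P? (x + suc s))
      ≡⟨ count-reindex n P? (λ x → ℕₚ.+-suc x s) ⟩
    count n (λ x → P? (suc (x + s)))
      ≡⟨ count-rotate₁ n (λ x → P? (x + s)) (subst (λ y → P y ⇔ P s) (ℕₚ.+-comm s n) (per s)) ⟩
    count n (λ x → P? (x + s))
      ≡⟨ count-rotate n s P? per ⟩
    count n P? ∎
    where open ≡-Reasoning

  private
    length-filter-tabulate : ∀ n {m} {P : Pred ℕ _} (P? : Decidable P) (f : Fin n → Fin m) (h : ℕ → ℕ) →
      (∀ i → toℕ (f i) ≡ h (toℕ i)) →
      length (filter (λ r → P? (toℕ r)) (tabulate f)) ≡ count n (λ x → P? (h x))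
    length-filter-tabulate zero    P? f h eq = refl
    length-filter-tabulate (suc n) {P = P} P? f h eq with P? (h 0)
    ... | yes p = begin
      length (filter (λ r → P? (toℕ r)) (tabulate f))
        ≡⟨ cong length (filter-accept (λ r → P? (toℕ r)) (subst P (sym (eq fzero)) p)) ⟩
      suc (length (filter (λ r → P? (toℕ r)) (tabulate (f ∘ fsuc))))
        ≡⟨ cong suc (length-filter-tabulate n P? (f ∘ fsuc) (h ∘ suc) (eq ∘ fsuc)) ⟩
      suc (count n (λ x → P? (h (suc x)))) ∎
      where open ≡-Reasoning
    ... | no ¬p = begin
      length (filter (λ r → P? (toℕ r)) (tabulate f))
        ≡⟨ cong length (filter-reject (λ r → P? (toℕ r)) (¬p ∘ subst P (eq fzero))) ⟩
      length (filter (λ r → P? (toℕ r)) (tabulate (f ∘ fsuc)))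
        ≡⟨ length-filter-tabulate n P? (f ∘ fsuc) (h ∘ suc) (eq ∘ fsuc) ⟩
      count n (λ x → P? (h (suc x))) ∎
      where open ≡-Reasoning

  hasCard-count : ∀ {n} {A : Pred (Fin n) _} {P : Pred ℕ _} (P? : Decidable P) →
                  (∀ r → A r ⇔ P (toℕ r)) → HasCard A (count n P?)
  hasCard-count {n} P? A⇔P =
    filter P?ᶠ (allFin n) ,
    filter⁺ P?ᶠ (allFin⁺ n) ,
    (λ r → (λ r∈ → Equivalence.from (A⇔P r) (proj₂ (∈-filter⁻ P?ᶠ {xs = allFin n} r∈))) ,
           (λ Ar → ∈-filter⁺ P?ᶠ (∈-allFin r) (Equivalence.to (A⇔P r) Ar))) ,
    length-filter-tabulate n P? (λ i → i) (λ x → x) (λ i → refl)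
    where
    P?ᶠ = λ (r : Fin n) → P? (toℕ r)

open Counting

module Congruence where

  open import Data.Integer.Base using (_+_; _-_; _*_)

  -- x ≡ y [mod n ] unfolds to a divisibility of ∣ x - y ∣, from which Agda cannot
  -- infer x, y and n; this record carries them as parameters.
  infix 4 _≋_⟨mod_⟩
  record _≋_⟨mod_⟩ (x y : ℤ) (n : ℕ) : Set where
    constructor ≋-intro
    field
      quotient : ℤ
      equation : x ≡ y + quotient * + n

  ≋⇒≡[mod] : ∀ {x y n} → x ≋ y ⟨mod n ⟩ → x ≡ y [mod n ]
  ≋⇒≡[mod] {y = y} {n} (≋-intro q refl) = ∣⇒∣ᵤ (Signed.divides q (lemma y q (+ n)))
    where
    lemma : ∀ y q n → y + q * n - y ≡ q * n
    lemma = solve-∀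

  ≡[mod]⇒≋ : ∀ {x y n} → x ≡ y [mod n ] → x ≋ y ⟨mod n ⟩
  ≡[mod]⇒≋ {x} {y} {n} x≡y with ∣ᵤ⇒∣ {+ n} {x - y} x≡y
  ... | Signed.divides q eq = ≋-intro q (begin
    x           ≡⟨ lemma x y ⟩
    y + (x - y) ≡⟨ cong (λ z → y + z) eq ⟩
    y + q * + n ∎)
    where
    open ≡-Reasoning
    lemma : ∀ x y → x ≡ y + (x - y)
    lemma = solve-∀

  ≋-refl : ∀ {x n} → x ≋ x ⟨mod n ⟩
  ≋-refl {x} {n} = ≋-intro (+ 0) (lemma x (+ n))
    where
    lemma : ∀ x n → x ≡ x + + 0 * n
    lemma = solve-∀

  ≋-reflexive : ∀ {x y n} → x ≡ y → x ≋ y ⟨mod n ⟩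
  ≋-reflexive refl = ≋-refl

  ≋-sym : ∀ {x y n} → x ≋ y ⟨mod n ⟩ → y ≋ x ⟨mod n ⟩
  ≋-sym {y = y} {n} (≋-intro q refl) = ≋-intro (- q) (lemma y q (+ n))
    where
    lemma : ∀ y q n → y ≡ y + q * n + - q * n
    lemma = solve-∀

  ≋-trans : ∀ {x y z n} → x ≋ y ⟨mod n ⟩ → y ≋ z ⟨mod n ⟩ → x ≋ z ⟨mod n ⟩
  ≋-trans {z = z} {n} (≋-intro q refl) (≋-intro q′ refl) = ≋-intro (q + q′) (lemma z q q′ (+ n))
    where
    lemma : ∀ z q q′ n → z + q′ * n + q * n ≡ z + (q + q′) * n
    lemma = solve-∀

  ≋-+ : ∀ {x y u v n} → x ≋ y ⟨mod n ⟩ → u ≋ v ⟨mod n ⟩ → x + u ≋ y + v ⟨mod n ⟩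
  ≋-+ {y = y} {v = v} {n} (≋-intro q refl) (≋-intro q′ refl) = ≋-intro (q + q′) (lemma y v q q′ (+ n))
    where
    lemma : ∀ y v q q′ n → y + q * n + (v + q′ * n) ≡ y + v + (q + q′) * n
    lemma = solve-∀

  ≋-* : ∀ {x y u v n} → x ≋ y ⟨mod n ⟩ → u ≋ v ⟨mod n ⟩ → x * u ≋ y * v ⟨mod n ⟩
  ≋-* {y = y} {v = v} {n} (≋-intro q refl) (≋-intro q′ refl) =
    ≋-intro (q * v + y * q′ + q * q′ * + n) (lemma y v q q′ (+ n))
    where
    lemma : ∀ y v q q′ n → (y + q * n) * (v + q′ * n) ≡ y * v + (q * v + y * q′ + q * q′ * n) * n
    lemma = solve-∀

  ≋-neg : ∀ {x y n} → x ≋ y ⟨mod n ⟩ → - x ≋ - y ⟨mod n ⟩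
  ≋-neg {y = y} {n} (≋-intro q refl) = ≋-intro (- q) (lemma y q (+ n))
    where
    lemma : ∀ y q n → - (y + q * n) ≡ - y + - q * n
    lemma = solve-∀

  ≋-∣ : ∀ {x y d n} → d ∣ n → x ≋ y ⟨mod n ⟩ → x ≋ y ⟨mod d ⟩
  ≋-∣ d∣n = ≡[mod]⇒≋ ∘ ∣-trans d∣n ∘ ≋⇒≡[mod]

  ≋-scale : ∀ {x y} k {n} → x ≋ y ⟨mod n ⟩ → + k * x ≋ + k * y ⟨mod k ℕ.* n ⟩
  ≋-scale {y = y} k {n} (≋-intro q refl) = ≋-intro q (begin
    + k * (y + q * + n)       ≡⟨ lemma (+ k) y q (+ n) ⟩
    + k * y + q * (+ k * + n) ≡⟨ cong (λ z → + k * y + q * z) (pos-* k n) ⟨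
    + k * y + q * + (k ℕ.* n) ∎)
    where
    open ≡-Reasoning
    lemma : ∀ k y q n → k * (y + q * n) ≡ k * y + q * (k * n)
    lemma = solve-∀

  ≋-cancel : ∀ {x y} k {n} .{{_ : NonZero k}} → + k * x ≋ + k * y ⟨mod k ℕ.* n ⟩ → x ≋ y ⟨mod n ⟩
  ≋-cancel {x} {y} k {n} (≋-intro q eq) = ≋-intro q (*-cancelˡ-≡ (+ k) x (y + q * + n) (begin
    + k * x                   ≡⟨ eq ⟩
    + k * y + q * + (k ℕ.* n) ≡⟨ cong (λ z → + k * y + q * z) (pos-* k n) ⟩
    + k * y + q * (+ k * + n) ≡⟨ lemma (+ k) y q (+ n) ⟨
    + k * (y + q * + n)       ∎))
    where
    open ≡-Reasoning
    lemma : ∀ k y q n → k * (y + q * n) ≡ k * y + q * (k * n)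
    lemma = solve-∀

  infix 4 _≋?_⟨mod_⟩
  _≋?_⟨mod_⟩ : ∀ x y n → Dec (x ≋ y ⟨mod n ⟩)
  x ≋? y ⟨mod n ⟩ = map′ ≡[mod]⇒≋ ≋⇒≡[mod] (n ∣? ∣ x - y ∣)

  residue : ∀ n .{{_ : NonZero n}} x → ∃ λ (r : Fin n) → x ≋ + toℕ r ⟨mod n ⟩
  residue n x = fromℕ< (n%ℕd<d x n) ,
    subst (λ r → x ≋ + r ⟨mod n ⟩) (sym (toℕ-fromℕ< (n%ℕd<d x n)))
          (≋-intro (x /ℕ n) (a≡a%ℕn+[a/ℕn]*n x n))

  ∀-by-residue : ∀ n .{{_ : NonZero n}} {P : ℤ → Set} → (∀ {x y} → x ≋ y ⟨mod n ⟩ → P x → P y) →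
                 (∀ (r : Fin n) → P (+ toℕ r)) → ∀ x → P x
  ∀-by-residue n resp onResidues x with residue n x
  ... | r , x≋r = resp (≋-sym x≋r) (onResidues r)

open Congruence

module Squares where

  open import Data.Integer.Base using (_+_; _-_; _*_)

  SquareMod : ℕ → ℤ → Set
  SquareMod n m = ∃ λ s → s * s ≋ m ⟨mod n ⟩

  squareMod-resp : ∀ {n m m′} → m ≋ m′ ⟨mod n ⟩ → SquareMod n m → SquareMod n m′
  squareMod-resp m≋m′ (s , s²≋m) = s , ≋-trans s²≋m m≋m′

  squareMod-∣ : ∀ {d n m} → d ∣ n → SquareMod n m → SquareMod d m
  squareMod-∣ d∣n (s , s²≋m) = s , ≋-∣ d∣n s²≋m

  squareMod? : ∀ n .{{_ : NonZero n}} m → Dec (SquareMod n m)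
  squareMod? n m = map′ (λ (r , r²≋m) → + toℕ r , r²≋m) fromRoot
    (any? λ (r : Fin n) → + toℕ r * + toℕ r ≋? m ⟨mod n ⟩)
    where
    fromRoot : SquareMod n m → ∃ λ (r : Fin n) → + toℕ r * + toℕ r ≋ m ⟨mod n ⟩
    fromRoot (s , s²≋m) with residue n s
    ... | r , s≋r = r , ≋-trans (≋-* (≋-sym s≋r) (≋-sym s≋r)) s²≋m

  squareMod-1 : ∀ m → SquareMod 1 m
  squareMod-1 m = + 0 , ≋-intro (- m) (lemma m)
    where
    lemma : ∀ m → + 0 * + 0 ≡ m + - m * + 1
    lemma = solve-∀

  squareMod-2 : ∀ m → SquareMod 2 m
  squareMod-2 m = let r , m≋r = residue 2 m in + toℕ r , ≋-trans (idempotent r) (≋-sym m≋r)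
    where
    idempotent : ∀ (r : Fin 2) → + toℕ r * + toℕ r ≋ + toℕ r ⟨mod 2 ⟩
    idempotent fzero        = ≋-refl
    idempotent (fsuc fzero) = ≋-refl

  squareMod-4 : ∀ {m} → SquareMod 4 m → m ≋ + 0 ⟨mod 4 ⟩ ⊎ m ≋ + 1 ⟨mod 4 ⟩
  squareMod-4 {m} = ∀-by-residue 4 resp table m
    where
    resp : ∀ {x y} → x ≋ y ⟨mod 4 ⟩ →
           (SquareMod 4 x → x ≋ + 0 ⟨mod 4 ⟩ ⊎ x ≋ + 1 ⟨mod 4 ⟩) →
           (SquareMod 4 y → y ≋ + 0 ⟨mod 4 ⟩ ⊎ y ≋ + 1 ⟨mod 4 ⟩)
    resp x≋y onX = Sum.map (≋-trans (≋-sym x≋y)) (≋-trans (≋-sym x≋y)) ∘ onX ∘ squareMod-resp (≋-sym x≋y)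
    table : ∀ (r : Fin 4) → SquareMod 4 (+ toℕ r) →
            + toℕ r ≋ + 0 ⟨mod 4 ⟩ ⊎ + toℕ r ≋ + 1 ⟨mod 4 ⟩
    table = from-yes (all? λ (r : Fin 4) → squareMod? 4 (+ toℕ r) →-dec
                                 (+ toℕ r ≋? + 0 ⟨mod 4 ⟩ ⊎-dec + toℕ r ≋? + 1 ⟨mod 4 ⟩))

  squareMod-8 : ∀ {m} → SquareMod 8 m → m ≋ + 0 ⟨mod 8 ⟩ ⊎ m ≋ + 1 ⟨mod 8 ⟩ ⊎ m ≋ + 4 ⟨mod 8 ⟩
  squareMod-8 {m} = ∀-by-residue 8 resp table m
    where
    resp : ∀ {x y} → x ≋ y ⟨mod 8 ⟩ →
           (SquareMod 8 x → x ≋ + 0 ⟨mod 8 ⟩ ⊎ x ≋ + 1 ⟨mod 8 ⟩ ⊎ x ≋ + 4 ⟨mod 8 ⟩) →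
           (SquareMod 8 y → y ≋ + 0 ⟨mod 8 ⟩ ⊎ y ≋ + 1 ⟨mod 8 ⟩ ⊎ y ≋ + 4 ⟨mod 8 ⟩)
    resp {x} {y} x≋y onX = Sum.map y≋ (Sum.map y≋ y≋) ∘ onX ∘ squareMod-resp (≋-sym x≋y)
      where
      y≋ : ∀ {z} → x ≋ z ⟨mod 8 ⟩ → y ≋ z ⟨mod 8 ⟩
      y≋ = ≋-trans (≋-sym x≋y)
    table : ∀ (r : Fin 8) → SquareMod 8 (+ toℕ r) →
            + toℕ r ≋ + 0 ⟨mod 8 ⟩ ⊎ + toℕ r ≋ + 1 ⟨mod 8 ⟩ ⊎ + toℕ r ≋ + 4 ⟨mod 8 ⟩
    table = from-yes (all? λ (r : Fin 8) → squareMod? 8 (+ toℕ r) →-dec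
      (+ toℕ r ≋? + 0 ⟨mod 8 ⟩ ⊎-dec + toℕ r ≋? + 1 ⟨mod 8 ⟩ ⊎-dec + toℕ r ≋? + 4 ⟨mod 8 ⟩))

  ¬squareMod-4 : ∀ {m} → m ≋ + 2 ⟨mod 4 ⟩ ⊎ m ≋ + 3 ⟨mod 4 ⟩ → ¬ SquareMod 4 m
  ¬squareMod-4 (inj₁ m≋2) = from-no (squareMod? 4 (+ 2)) ∘ squareMod-resp m≋2
  ¬squareMod-4 (inj₂ m≋3) = from-no (squareMod? 4 (+ 3)) ∘ squareMod-resp m≋3

  odd-squareMod-4 : ∀ {m} → m ≋ + 1 ⟨mod 2 ⟩ → SquareMod 4 m → m ≋ + 1 ⟨mod 4 ⟩
  odd-squareMod-4 {m} m≋1 sq =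
    Sum.[ ⊥-elim ∘ from-no (+ 1 ≋? + 0 ⟨mod 2 ⟩) ∘ mod2 , id ]′ (squareMod-4 sq)
    where
    mod2 : ∀ {r} → m ≋ r ⟨mod 4 ⟩ → + 1 ≋ r ⟨mod 2 ⟩
    mod2 m≋r = ≋-trans (≋-sym m≋1) (≋-∣ (divides 2 refl) m≋r)

  odd-squareMod-8 : ∀ {m} → m ≋ + 1 ⟨mod 2 ⟩ → SquareMod 8 m → m ≋ + 1 ⟨mod 8 ⟩
  odd-squareMod-8 {m} m≋1 sq = Sum.[ ⊥-elim ∘ from-no (+ 1 ≋? + 0 ⟨mod 2 ⟩) ∘ mod2 ,
    Sum.[ id , ⊥-elim ∘ from-no (+ 1 ≋? + 4 ⟨mod 2 ⟩) ∘ mod2 ]′ ]′ (squareMod-8 sq)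
    where
    mod2 : ∀ {r} → m ≋ r ⟨mod 8 ⟩ → + 1 ≋ r ⟨mod 2 ⟩
    mod2 m≋r = ≋-trans (≋-sym m≋1) (≋-∣ (divides 4 refl) m≋r)

  squareMod-×4 : ∀ {n m} → SquareMod n m → SquareMod (4 ℕ.* n) (+ 4 * m)
  squareMod-×4 (s , s²≋m) = + 2 * s , ≋-trans (≋-reflexive (lemma s)) (≋-scale 4 s²≋m)
    where
    lemma : ∀ s → (+ 2 * s) * (+ 2 * s) ≡ + 4 * (s * s)
    lemma = solve-∀

  squareMod-÷4 : ∀ {n m} → SquareMod (4 ℕ.* n) (+ 4 * m) → SquareMod n m
  squareMod-÷4 {n} {m} (s , s²≋4m) with residue 2 s
  ... | fzero , ≋-intro σ refl = σ , ≋-cancel 4 (≋-trans (≋-reflexive (lemma σ)) s²≋4m)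
    where
    lemma : ∀ σ → + 4 * (σ * σ) ≡ (+ 0 + σ * + 2) * (+ 0 + σ * + 2)
    lemma = solve-∀
  ... | fsuc fzero , ≋-intro σ refl = ⊥-elim (from-no (+ 1 ≋? + 0 ⟨mod 4 ⟩)
    (≋-trans (≋-intro (- (σ * σ + σ)) (odd² σ)) (≋-trans (≋-∣ (m∣m*n n) s²≋4m) (≋-intro m (4m m)))))
    where
    odd² : ∀ σ → + 1 ≡ (+ 1 + σ * + 2) * (+ 1 + σ * + 2) + - (σ * σ + σ) * + 4
    odd² = solve-∀
    4m : ∀ m → + 4 * m ≡ + 0 + m * + 4
    4m = solve-∀

  pos-2^-+ : ∀ j k → + (2 ^ (j ℕ.+ k)) ≡ + (2 ^ j) * + (2 ^ k)
  pos-2^-+ j k = trans (cong +_ (ℕₚ.^-distribˡ-+-* 2 j k)) (pos-* (2 ^ j) (2 ^ k))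

  2^[2+n]≡4*2^n : ∀ n → 2 ^ (2 ℕ.+ n) ≡ 4 ℕ.* 2 ^ n
  2^[2+n]≡4*2^n = ℕₚ.^-distribˡ-+-* 2 2

  2^j∣2^[j+k] : ∀ j k → 2 ^ j ∣ 2 ^ (j ℕ.+ k)
  2^j∣2^[j+k] j k = divides (2 ^ k) (trans (ℕₚ.^-distribˡ-+-* 2 j k) (ℕₚ.*-comm (2 ^ j) (2 ^ k)))

  2^≢0 : ∀ T → NonZero (2 ^ T)
  2^≢0 T = ℕₚ.m^n≢0 2 T

  squareMod2^? : ∀ T m → Dec (SquareMod (2 ^ T) m)
  squareMod2^? T = squareMod? (2 ^ T) {{2^≢0 T}}

  squareMod-4*⇔ : ∀ T {m} → SquareMod (2 ^ (2 ℕ.+ T)) (+ 4 * m) ⇔ SquareMod (2 ^ T) m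
  squareMod-4*⇔ T {m} = mk⇔ (squareMod-÷4 ∘ subst (λ n → SquareMod n (+ 4 * m)) (2^[2+n]≡4*2^n T))
                            (subst (λ n → SquareMod n (+ 4 * m)) (sym (2^[2+n]≡4*2^n T)) ∘ squareMod-×4)

  private
    lift-odd-root : ∀ k {m} σ q (r : Fin 2) →
      (+ 2 * σ + + 1) * (+ 2 * σ + + 1) ≡ m + (+ toℕ r + q * + 2) * + (2 ^ (3 ℕ.+ k)) →
      ∃ λ σ′ → (+ 2 * σ′ + + 1) * (+ 2 * σ′ + + 1) ≋ m ⟨mod 2 ^ (4 ℕ.+ k) ⟩
    lift-odd-root k {m} σ q fzero eq = σ , ≋-intro q (begin
      (+ 2 * σ + + 1) * (+ 2 * σ + + 1)       ≡⟨ eq ⟩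
      m + (+ 0 + q * + 2) * + (2 ^ (3 ℕ.+ k)) ≡⟨ cong (λ z → m + (+ 0 + q * + 2) * z) (pos-2^-+ 3 k) ⟩
      m + (+ 0 + q * + 2) * (+ 8 * R)         ≡⟨ collect m q R ⟩
      m + q * (+ 16 * R)                      ≡⟨ cong (λ z → m + q * z) (pos-2^-+ 4 k) ⟨
      m + q * + (2 ^ (4 ℕ.+ k))               ∎)
      where
      open ≡-Reasoning
      R = + (2 ^ k)
      collect : ∀ m q R → m + (+ 0 + q * + 2) * (+ 8 * R) ≡ m + q * (+ 16 * R)
      collect = solve-∀
    lift-odd-root k {m} σ q (fsuc fzero) eq = σ + + 2 * R , ≋-intro (q + σ + + 1 + R) (begin
      (+ 2 * (σ + + 2 * R) + + 1) * (+ 2 * (σ + + 2 * R) + + 1)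
        ≡⟨ expand σ R ⟩
      (+ 2 * σ + + 1) * (+ 2 * σ + + 1) + + 8 * R * (+ 2 * σ + + 1) + + 16 * R * R
        ≡⟨ cong (λ z → z + + 8 * R * (+ 2 * σ + + 1) + + 16 * R * R) eq ⟩
      m + (+ 1 + q * + 2) * + (2 ^ (3 ℕ.+ k)) + + 8 * R * (+ 2 * σ + + 1) + + 16 * R * R
        ≡⟨ cong (λ z → m + (+ 1 + q * + 2) * z + + 8 * R * (+ 2 * σ + + 1) + + 16 * R * R) (pos-2^-+ 3 k) ⟩
      m + (+ 1 + q * + 2) * (+ 8 * R) + + 8 * R * (+ 2 * σ + + 1) + + 16 * R * R
        ≡⟨ collect m q σ R ⟩
      m + (q + σ + + 1 + R) * (+ 16 * R)
        ≡⟨ cong (λ z → m + (q + σ + + 1 + R) * z) (pos-2^-+ 4 k) ⟨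
      m + (q + σ + + 1 + R) * + (2 ^ (4 ℕ.+ k)) ∎)
      where
      open ≡-Reasoning
      R = + (2 ^ k)
      expand : ∀ σ R → (+ 2 * (σ + + 2 * R) + + 1) * (+ 2 * (σ + + 2 * R) + + 1)
                     ≡ (+ 2 * σ + + 1) * (+ 2 * σ + + 1) + + 8 * R * (+ 2 * σ + + 1) + + 16 * R * R
      expand = solve-∀
      collect : ∀ m q σ R → m + (+ 1 + q * + 2) * (+ 8 * R) + + 8 * R * (+ 2 * σ + + 1) + + 16 * R * R
                          ≡ m + (q + σ + + 1 + R) * (+ 16 * R)
      collect = solve-∀

  -- Hensel lifting: if (2σ+1)² ≡ m mod 2ᵏ⁺³ fails mod 2ᵏ⁺⁴, then 2σ + 1 + 2ᵏ⁺² repairs it.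
  odd-squareRoot : ∀ k {m} → m ≋ + 1 ⟨mod 8 ⟩ →
                   ∃ λ σ → (+ 2 * σ + + 1) * (+ 2 * σ + + 1) ≋ m ⟨mod 2 ^ (3 ℕ.+ k) ⟩
  odd-squareRoot zero    m≋1 = + 0 , ≋-sym m≋1
  odd-squareRoot (suc k) m≋1 with odd-squareRoot k m≋1
  ... | σ , ≋-intro q eq with residue 2 q
  ... | r , ≋-intro q′ refl = lift-odd-root k σ q′ r eq

  squareMod-≡1[mod8] : ∀ k {m} → m ≋ + 1 ⟨mod 8 ⟩ → SquareMod (2 ^ (3 ℕ.+ k)) m
  squareMod-≡1[mod8] k m≋1 = let σ , root = odd-squareRoot k m≋1 in + 2 * σ + + 1 , root

  -- The residues of the odd squares (≡ 1 mod 8) and of four times them (≡ 4 mod 32) modulo 2ᵗ, t ≥ 5.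
  SquareShape : ℤ → Set
  SquareShape m = m ≋ + 1 ⟨mod 8 ⟩ ⊎ m ≋ + 4 ⟨mod 32 ⟩

  squareShape? : ∀ m → Dec (SquareShape m)
  squareShape? m = m ≋? + 1 ⟨mod 8 ⟩ ⊎-dec m ≋? + 4 ⟨mod 32 ⟩

  squareShape-resp : ∀ {m m′} → m ≋ m′ ⟨mod 32 ⟩ → SquareShape m → SquareShape m′
  squareShape-resp m≋m′ = Sum.map (≋-trans (≋-sym (≋-∣ (divides 4 refl) m≋m′))) (≋-trans (≋-sym m≋m′))

  squareMod⇔squareShape : ∀ k {m} → ¬ (m ≋ + 0 ⟨mod 8 ⟩) → SquareMod (2 ^ (5 ℕ.+ k)) m ⇔ SquareShape m
  squareMod⇔squareShape k {m} m≢0 = mk⇔ to from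
    where
    factor : ∀ q → + 4 + q * + 8 ≡ + 4 * (+ 1 + q * + 2)
    factor = solve-∀
    expand : ∀ q → + 4 * (+ 1 + q * + 8) ≡ + 4 + q * + 32
    expand = solve-∀
    four : SquareMod (2 ^ (5 ℕ.+ k)) m → m ≋ + 4 ⟨mod 8 ⟩ → m ≋ + 4 ⟨mod 32 ⟩
    four sq (≋-intro q refl) = lift (odd-squareMod-8 (≋-intro q refl)
      (squareMod-∣ (2^j∣2^[j+k] 3 k)
        (Equivalence.to (squareMod-4*⇔ (3 ℕ.+ k)) (squareMod-resp (≋-reflexive (factor q)) sq))))
      where
      lift : + 1 + q * + 2 ≋ + 1 ⟨mod 8 ⟩ → + 4 + q * + 8 ≋ + 4 ⟨mod 32 ⟩
      lift (≋-intro q₂ eq) = ≋-intro q₂ (trans (factor q) (trans (cong (λ z → + 4 * z) eq) (expand q₂)))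
    to : SquareMod (2 ^ (5 ℕ.+ k)) m → SquareShape m
    to sq = Sum.[ ⊥-elim ∘ m≢0 , Sum.[ inj₁ , inj₂ ∘ four sq ]′ ]′
      (squareMod-8 (squareMod-∣ (2^j∣2^[j+k] 3 (2 ℕ.+ k)) sq))
    from : SquareShape m → SquareMod (2 ^ (5 ℕ.+ k)) m
    from (inj₁ m≋1) = squareMod-≡1[mod8] (2 ℕ.+ k) m≋1
    from (inj₂ (≋-intro q refl)) =
      squareMod-resp (≋-reflexive (expand q))
        (Equivalence.from (squareMod-4*⇔ (3 ℕ.+ k)) (squareMod-≡1[mod8] k (≋-intro q refl)))

open Squares

module Characterisation where

  open import Data.Integer.Base using (_+_; _-_; _*_)

  FactorDifference : ℕ → ℤ → ℕ → Set
  FactorDifference n c r = ∃ λ X → ∃ λ Y → X * Y ≋ c ⟨mod n ⟩ × X - Y ≋ + r ⟨mod n ⟩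

  -- X Y ≡ c and X - Y ≡ 2e  iff  (Y + e)² ≡ c + e²,  with X = s + e, Y = s - e conversely.
  factorDifference-even⇔ : ∀ {n c} e → FactorDifference n c (2 ℕ.* e) ⇔ SquareMod n (c + + e * + e)
  factorDifference-even⇔ {n} {c} e = mk⇔ to from
    where
    to : FactorDifference n c (2 ℕ.* e) → SquareMod n (c + + e * + e)
    to (X , Y , XY≋c , X-Y≋2e) = Y + + e , ≋-trans (≋-reflexive (square Y (+ e))) (≋-+ YX≋c ≋-refl)
      where
      square : ∀ Y e → (Y + e) * (Y + e) ≡ Y * (Y + + 2 * e) + e * e
      square = solve-∀
      shift : ∀ X Y → X ≡ Y + (X - Y)
      shift = solve-∀
      X≋Y+2e : X ≋ Y + + 2 * + e ⟨mod n ⟩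
      X≋Y+2e = ≋-trans (≋-reflexive (shift X Y))
                       (≋-+ (≋-refl {Y}) (subst (λ z → X - Y ≋ z ⟨mod n ⟩) (pos-* 2 e) X-Y≋2e))
      YX≋c : Y * (Y + + 2 * + e) ≋ c ⟨mod n ⟩
      YX≋c = ≋-trans (≋-* (≋-refl {Y}) (≋-sym X≋Y+2e)) (≋-trans (≋-reflexive (*-comm Y X)) XY≋c)
    from : SquareMod n (c + + e * + e) → FactorDifference n c (2 ℕ.* e)
    from (s , s²≋c+e²) = s + + e , s - + e ,
      ≋-trans (≋-reflexive (product s (+ e)))
              (≋-trans (≋-+ s²≋c+e² ≋-refl) (≋-reflexive (cancel c (+ e)))) ,
      ≋-reflexive (trans (difference s (+ e)) (sym (pos-* 2 e)))
      where
      product : ∀ s e → (s + e) * (s - e) ≡ s * s + - (e * e)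
      product = solve-∀
      cancel : ∀ c e → c + e * e + - (e * e) ≡ c
      cancel = solve-∀
      difference : ∀ s e → s + e - (s - e) ≡ + 2 * e
      difference = solve-∀

  consecutive-product-even : ∀ Y → (Y + + 1) * Y ≋ + 0 ⟨mod 2 ⟩
  consecutive-product-even = ∀-by-residue 2 resp
    (from-yes (all? λ (r : Fin 2) → (+ toℕ r + + 1) * + toℕ r ≋? + 0 ⟨mod 2 ⟩))
    where
    resp : ∀ {Y Y′} → Y ≋ Y′ ⟨mod 2 ⟩ →
           (Y + + 1) * Y ≋ + 0 ⟨mod 2 ⟩ → (Y′ + + 1) * Y′ ≋ + 0 ⟨mod 2 ⟩
    resp Y≋Y′ = ≋-trans (≋-* (≋-+ (≋-sym Y≋Y′) ≋-refl) (≋-sym Y≋Y′))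

  -- A product of two factors of odd difference is even.
  ¬factorDifference-odd : ∀ {n c} e → 2 ∣ n → c ≋ + 1 ⟨mod 2 ⟩ → ¬ FactorDifference n c (suc (2 ℕ.* e))
  ¬factorDifference-odd {n} {c} e 2∣n c-odd (X , Y , XY≋c , X-Y≋r) =
    from-no (+ 1 ≋? + 0 ⟨mod 2 ⟩) (≋-trans (≋-sym c-odd) (≋-trans (≋-sym (≋-∣ 2∣n XY≋c)) XY≋0))
    where
    r≋1 : X - Y ≋ + 1 ⟨mod 2 ⟩
    r≋1 = ≋-trans (≋-∣ 2∣n X-Y≋r)
      (≋-intro (+ e) (trans (pos-+ 1 (2 ℕ.* e)) (cong (λ z → + 1 + z) (trans (pos-* 2 e) (*-comm (+ 2) (+ e))))))
    X≋Y+1 : X ≋ Y + + 1 ⟨mod 2 ⟩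
    X≋Y+1 = ≋-trans (≋-reflexive (shift′ X Y)) (≋-+ (≋-refl {Y}) r≋1)
      where
      shift′ : ∀ X Y → X ≡ Y + (X - Y)
      shift′ = solve-∀
    XY≋0 : X * Y ≋ + 0 ⟨mod 2 ⟩
    XY≋0 = ≋-trans (≋-* X≋Y+1 ≋-refl) (consecutive-product-even Y)

  data EvenOrOdd : ℕ → Set where
    even : ∀ e → EvenOrOdd (2 ℕ.* e)
    odd  : ∀ e → EvenOrOdd (suc (2 ℕ.* e))

  evenOrOdd : ∀ n → EvenOrOdd n
  evenOrOdd zero = even 0
  evenOrOdd (suc n) with evenOrOdd n
  ... | even e = odd e
  ... | odd e  = subst EvenOrOdd (cong suc (ℕₚ.+-suc e (e ℕ.+ 0))) (even (suc e))

  factorDifference? : ∀ n .{{_ : NonZero n}} {c} → 2 ∣ n → c ≋ + 1 ⟨mod 2 ⟩ →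
                      Decidable (FactorDifference n c)
  factorDifference? n {c} 2∣n c-odd r with evenOrOdd r
  ... | even e = map (⇔-sym (factorDifference-even⇔ e)) (squareMod? n (c + + e * + e))
  ... | odd e  = no (¬factorDifference-odd e 2∣n c-odd)

  shiftedSquareCount : (m : ℕ) .{{_ : NonZero m}} → ℤ → ℕ
  shiftedSquareCount m c = count m (λ e → squareMod? (2 ℕ.* m) {{ℕₚ.m*n≢0 2 m}} (c + + e * + e))

  shiftedSquareCount-resp : ∀ m .{{_ : NonZero m}} {c c′} → c ≋ c′ ⟨mod 2 ℕ.* m ⟩ →
                            shiftedSquareCount m c ≡ shiftedSquareCount m c′
  shiftedSquareCount-resp m {c} {c′} c≋c′ = count-cong m _ _ λ e _ →
    mk⇔ (squareMod-resp (≋-+ c≋c′ ≋-refl)) (squareMod-resp (≋-+ (≋-sym c≋c′) ≋-refl))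

  shiftedSquareCount-by-residue : ∀ m .{{_ : NonZero m}} {d j E} → d ∣ 2 ℕ.* m →
    (∀ (r : Fin (2 ℕ.* m)) → + toℕ r ≋ + j ⟨mod d ⟩ → shiftedSquareCount m (+ toℕ r) ≡ E) →
    ∀ c → c ≋ + j ⟨mod d ⟩ → shiftedSquareCount m c ≡ E
  shiftedSquareCount-by-residue m {d} {j} {E} d∣2m = ∀-by-residue (2 ℕ.* m) {{ℕₚ.m*n≢0 2 m}} resp
    where
    resp : ∀ {c c′} → c ≋ c′ ⟨mod 2 ℕ.* m ⟩ → (c ≋ + j ⟨mod d ⟩ → shiftedSquareCount m c ≡ E) →
           c′ ≋ + j ⟨mod d ⟩ → shiftedSquareCount m c′ ≡ E
    resp c≋c′ onC c′≋j =
      trans (shiftedSquareCount-resp m (≋-sym c≋c′)) (onC (≋-trans (≋-∣ d∣2m c≋c′) c′≋j))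

  card-factorDifferences : ∀ m .{{_ : NonZero m}} {c} {A : Pred (Fin (2 ℕ.* m)) _} → c ≋ + 1 ⟨mod 2 ⟩ →
    (∀ r → A r ⇔ FactorDifference (2 ℕ.* m) c (toℕ r)) → HasCard A (shiftedSquareCount m c)
  card-factorDifferences m {c} c-odd A⇔ = subst (HasCard _) count≡ (hasCard-count P? A⇔)
    where
    instance
      2m≢0 : NonZero (2 ℕ.* m)
      2m≢0 = ℕₚ.m*n≢0 2 m
    P? = factorDifference? (2 ℕ.* m) (m∣m*n m) c-odd
    count≡ : count (2 ℕ.* m) P? ≡ shiftedSquareCount m c
    count≡ = begin
      count (2 ℕ.* m) P?
        ≡⟨ count-evens-odds m P? ⟩
      count m (λ e → P? (2 ℕ.* e)) ℕ.+ count m (λ e → P? (suc (2 ℕ.* e)))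
        ≡⟨ cong₂ ℕ._+_ (count-cong m _ _ (λ e _ → factorDifference-even⇔ e))
                        (count-none m _ (λ e → ¬factorDifference-odd e (m∣m*n m) c-odd)) ⟩
      shiftedSquareCount m c ℕ.+ 0
        ≡⟨ ℕₚ.+-identityʳ _ ⟩
      shiftedSquareCount m c ∎
      where open ≡-Reasoning

  private
    positive-residue : ∀ {n a X Y} (x : Fin n) → 2 ∣ n → a ≋ + 1 ⟨mod 2 ⟩ →
                       X * Y ≋ a ⟨mod n ⟩ → X ≋ + toℕ x ⟨mod n ⟩ → 1 ≤ toℕ x
    positive-residue {Y = Y} fzero 2∣n a-odd XY≋a X≋0 = ⊥-elim (from-no (+ 1 ≋? + 0 ⟨mod 2 ⟩)
      (≋-trans (≋-sym a-odd)
        (≋-∣ 2∣n (≋-trans (≋-sym XY≋a) (≋-trans (≋-* X≋0 ≋-refl) (≋-reflexive (*-zeroˡ Y)))))))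
    positive-residue (fsuc x)      2∣n a-odd XY≋a X≋x = s≤s z≤n

    residue-factors : ∀ {n a X Y} .{{_ : NonZero n}} → 2 ∣ n → a ≋ + 1 ⟨mod 2 ⟩ → X * Y ≋ a ⟨mod n ⟩ →
                      ∃ λ x → ∃ λ y → H₂ a n x y × X ≋ + x ⟨mod n ⟩ × Y ≋ + y ⟨mod n ⟩
    residue-factors {n} {a} {X} {Y} 2∣n a-odd XY≋a =
      let x , X≋x = residue n X
          y , Y≋y = residue n Y
      in toℕ x , toℕ y ,
         ( (positive-residue x 2∣n a-odd XY≋a X≋x , toℕ<n x)
         , (positive-residue y 2∣n a-odd (≋-trans (≋-reflexive (*-comm Y X)) XY≋a) Y≋y , toℕ<n y)
         , ≋⇒≡[mod] (≋-trans (≋-reflexive (pos-* (toℕ x) (toℕ y)))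
                             (≋-trans (≋-* (≋-sym X≋x) (≋-sym Y≋y)) XY≋a))) ,
         X≋x , Y≋y

  InD̄₂⇔factorDifference : ∀ {n a} .{{_ : NonZero n}} → 2 ∣ n → a ≋ + 1 ⟨mod 2 ⟩ →
                          ∀ r → InD̄₂ a n r ⇔ FactorDifference n a (toℕ r)
  InD̄₂⇔factorDifference {n} {a} 2∣n a-odd r = mk⇔ to from
    where
    to : InD̄₂ a n r → FactorDifference n a (toℕ r)
    to (x , y , (_ , _ , xy≡a) , x-y≡r) =
      + x , + y , ≋-trans (≋-reflexive (sym (pos-* x y))) (≡[mod]⇒≋ xy≡a) , ≡[mod]⇒≋ x-y≡r
    from : FactorDifference n a (toℕ r) → InD̄₂ a n r
    from (X , Y , XY≋a , X-Y≋r) =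
      let x , y , H , X≋x , Y≋y = residue-factors {X = X} {Y} 2∣n a-odd XY≋a
      in x , y , H , ≋⇒≡[mod] (≋-trans (≋-+ (≋-sym X≋x) (≋-neg (≋-sym Y≋y))) X-Y≋r)

  InS̄₂⇔factorDifference : ∀ {n a} .{{_ : NonZero n}} → 2 ∣ n → a ≋ + 1 ⟨mod 2 ⟩ →
                          ∀ r → InS̄₂ a n r ⇔ FactorDifference n (- a) (toℕ r)
  InS̄₂⇔factorDifference {n} {a} 2∣n a-odd r = mk⇔ to from
    where
    negate : ∀ X Y → X * - Y ≡ - (X * Y)
    negate = solve-∀
    to : InS̄₂ a n r → FactorDifference n (- a) (toℕ r)
    to (x , y , (_ , _ , xy≡a) , x+y≡r) =
      + x , - + y ,
      ≋-trans (≋-reflexive (trans (negate (+ x) (+ y)) (cong -_ (sym (pos-* x y)))))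
              (≋-neg (≡[mod]⇒≋ xy≡a)) ,
      ≋-trans (≋-reflexive (trans (neg-involutive-sub (+ x) (+ y)) (sym (pos-+ x y)))) (≡[mod]⇒≋ x+y≡r)
      where
      neg-involutive-sub : ∀ X Y → X - - Y ≡ X + Y
      neg-involutive-sub = solve-∀
    from : FactorDifference n (- a) (toℕ r) → InS̄₂ a n r
    from (X , Y , XY≋-a , X-Y≋r) =
      let x , y , H , X≋x , -Y≋y = residue-factors {X = X} { - Y} 2∣n a-odd X[-Y]≋a
      in x , y , H ,
         ≋⇒≡[mod] (≋-trans (≋-reflexive (pos-+ x y)) (≋-trans (≋-+ (≋-sym X≋x) (≋-sym -Y≋y)) X-Y≋r))
      where
      X[-Y]≋a : X * - Y ≋ a ⟨mod n ⟩
      X[-Y]≋a = ≋-trans (≋-reflexive (negate X Y)) (≋-trans (≋-neg XY≋-a) (≋-reflexive (neg-involutive a)))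

  card-D̄₂ : ∀ m .{{_ : NonZero m}} {a} → a ≋ + 1 ⟨mod 2 ⟩ →
            HasCard (InD̄₂ a (2 ℕ.* m)) (shiftedSquareCount m a)
  card-D̄₂ m a-odd =
    card-factorDifferences m a-odd (InD̄₂⇔factorDifference {{ℕₚ.m*n≢0 2 m}} (m∣m*n m) a-odd)

  card-S̄₂ : ∀ m .{{_ : NonZero m}} {a} → a ≋ + 1 ⟨mod 2 ⟩ →
            HasCard (InS̄₂ a (2 ℕ.* m)) (shiftedSquareCount m (- a))
  card-S̄₂ m a-odd = card-factorDifferences m (≋-trans (≋-neg a-odd) (from-yes (- + 1 ≋? + 1 ⟨mod 2 ⟩)))
    (InS̄₂⇔factorDifference {{ℕₚ.m*n≢0 2 m}} (m∣m*n m) a-odd)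

open Characterisation

module PeriodicCase where

  open import Data.Integer.Base using (_+_; _-_; _*_)

  ≡7-of-odd+square≡0 : ∀ {c} e → c ≋ + 1 ⟨mod 2 ⟩ → c + e * e ≋ + 0 ⟨mod 8 ⟩ → c ≋ + 7 ⟨mod 8 ⟩
  ≡7-of-odd+square≡0 {c} e c-odd c+e²≋0 =
    Sum.[ ⊥-elim ∘ from-no (+ 1 ≋? + 0 ⟨mod 2 ⟩) ∘ odd≋ ∘ c≋-
        , Sum.[ (λ e²≋1 → ≋-trans (c≋- e²≋1) (from-yes (- + 1 ≋? + 7 ⟨mod 8 ⟩)))
              , ⊥-elim ∘ from-no (+ 1 ≋? - + 4 ⟨mod 2 ⟩) ∘ odd≋ ∘ c≋- ]′ ]′
      (squareMod-8 (e , ≋-refl))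
    where
    c≋- : ∀ {s} → e * e ≋ s ⟨mod 8 ⟩ → c ≋ - s ⟨mod 8 ⟩
    c≋- {s} e²≋s = ≋-trans (≋-reflexive (shift c s))
      (≋-trans (≋-+ (≋-trans (≋-+ (≋-refl {c}) (≋-sym e²≋s)) c+e²≋0) (≋-refl { - s}))
               (≋-reflexive (+-identityˡ (- s))))
      where
      shift : ∀ c s → c ≡ c + s + - s
      shift = solve-∀
    odd≋ : ∀ {s} → c ≋ s ⟨mod 8 ⟩ → + 1 ≋ s ⟨mod 2 ⟩
    odd≋ c≋s = ≋-trans (≋-sym c-odd) (≋-∣ (divides 4 refl) c≋s)

  squareShapeCount : ℤ → ℕ
  squareShapeCount c = count 16 (λ e → squareShape? (c + + e * + e))

  shiftedSquareCount-periodic : ∀ k {c} → (∀ e → ¬ (c + e * e ≋ + 0 ⟨mod 8 ⟩)) →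
    shiftedSquareCount (2 ^ (4 ℕ.+ k)) {{2^≢0 (4 ℕ.+ k)}} c ≡ 2 ^ k ℕ.* squareShapeCount c
  shiftedSquareCount-periodic k {c} c+e²≢0 = begin
    count (2 ^ (4 ℕ.+ k)) (λ e → squareMod? (2 ^ (5 ℕ.+ k)) {{_}} (c + + e * + e))
      ≡⟨ count-cong (2 ^ (4 ℕ.+ k)) _ _ (λ e _ → squareMod⇔squareShape k (c+e²≢0 (+ e))) ⟩
    count (2 ^ (4 ℕ.+ k)) P?
      ≡⟨ cong (λ n → count n P?) (trans (ℕₚ.^-distribˡ-+-* 2 4 k) (ℕₚ.*-comm 16 (2 ^ k))) ⟩
    count (2 ^ k ℕ.* 16) P?
      ≡⟨ count-periodic (2 ^ k) 16 P? (λ x → mk⇔ (squareShape-resp (period x))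
                                                  (squareShape-resp (≋-sym (period x)))) ⟩
    2 ^ k ℕ.* squareShapeCount c ∎
    where
    open ≡-Reasoning
    P? = λ (e : ℕ) → squareShape? (c + + e * + e)
    expand : ∀ c x → c + (x + + 16) * (x + + 16) ≡ c + x * x + (x + + 8) * + 32
    expand = solve-∀
    period : ∀ x → c + + (x ℕ.+ 16) * + (x ℕ.+ 16) ≋ c + + x * + x ⟨mod 32 ⟩
    period x = ≋-intro (+ x + + 8) (trans (cong (λ z → c + z * z) (pos-+ x 16)) (expand c (+ x)))

  squareShapeCount-by-residue : ∀ j E →
    (∀ (r : Fin 32) → + toℕ r ≋ + j ⟨mod 8 ⟩ → squareShapeCount (+ toℕ r) ≡ E) →
                                ∀ c → c ≋ + j ⟨mod 8 ⟩ → squareShapeCount c ≡ E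
  squareShapeCount-by-residue j E table = ∀-by-residue 32 resp table
    where
    resp : ∀ {c c′} → c ≋ c′ ⟨mod 32 ⟩ → (c ≋ + j ⟨mod 8 ⟩ → squareShapeCount c ≡ E) →
           c′ ≋ + j ⟨mod 8 ⟩ → squareShapeCount c′ ≡ E
    resp {c} {c′} c≋c′ onC c′≋j =
      trans (count-cong 16 (λ e → squareShape? (c′ + + e * + e)) (λ e → squareShape? (c + + e * + e)) λ e _ →
        mk⇔ (squareShape-resp (≋-+ (≋-sym c≋c′) ≋-refl)) (squareShape-resp (≋-+ c≋c′ ≋-refl)))
      (onC (≋-trans (≋-∣ (divides 4 refl) c≋c′) c′≋j))

  shiftedSquareCount-nonSeven : ∀ k {c} j E →
    c ≋ + j ⟨mod 8 ⟩ → + j ≋ + 1 ⟨mod 2 ⟩ → ¬ (+ j ≋ + 7 ⟨mod 8 ⟩) →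
    (∀ c → c ≋ + j ⟨mod 8 ⟩ → squareShapeCount c ≡ E) →
    shiftedSquareCount (2 ^ (4 ℕ.+ k)) {{2^≢0 (4 ℕ.+ k)}} c ≡ 2 ^ k ℕ.* E
  shiftedSquareCount-nonSeven k {c} j E c≋j j-odd j≢7 squareShapeCount≡E =
    trans (shiftedSquareCount-periodic k {c}
             (λ e → j≢7 ∘ ≋-trans (≋-sym c≋j) ∘ ≡7-of-odd+square≡0 e c-odd))
          (cong (λ n → 2 ^ k ℕ.* n) (squareShapeCount≡E c c≋j))
    where
    c-odd : c ≋ + 1 ⟨mod 2 ⟩
    c-odd = ≋-trans (≋-∣ (divides 4 refl) c≋j) j-odd

  squareShapeCount-≡1 : ∀ c → c ≋ + 1 ⟨mod 8 ⟩ → squareShapeCount c ≡ 4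
  squareShapeCount-≡1 = squareShapeCount-by-residue 1 4 (from-yes (all? λ (r : Fin 32) →
    (+ toℕ r ≋? + 1 ⟨mod 8 ⟩) →-dec (squareShapeCount (+ toℕ r) ℕₚ.≟ 4)))

  squareShapeCount-≡5 : ∀ c → c ≋ + 5 ⟨mod 8 ⟩ → squareShapeCount c ≡ 4
  squareShapeCount-≡5 = squareShapeCount-by-residue 5 4 (from-yes (all? λ (r : Fin 32) →
    (+ toℕ r ≋? + 5 ⟨mod 8 ⟩) →-dec (squareShapeCount (+ toℕ r) ℕₚ.≟ 4)))

  squareShapeCount-≡3 : ∀ c → c ≋ + 3 ⟨mod 8 ⟩ → squareShapeCount c ≡ 2
  squareShapeCount-≡3 = squareShapeCount-by-residue 3 2 (from-yes (all? λ (r : Fin 32) →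
    (+ toℕ r ≋? + 3 ⟨mod 8 ⟩) →-dec (squareShapeCount (+ toℕ r) ℕₚ.≟ 2)))

  shiftedSquareCount-≡1 : ∀ k {c} → c ≋ + 1 ⟨mod 8 ⟩ →
                          shiftedSquareCount (2 ^ (4 ℕ.+ k)) {{2^≢0 (4 ℕ.+ k)}} c ≡ 2 ^ (2 ℕ.+ k)
  shiftedSquareCount-≡1 k {c} c≋1 = trans
    (shiftedSquareCount-nonSeven k {c} 1 4 c≋1 ≋-refl (from-no (+ 1 ≋? + 7 ⟨mod 8 ⟩)) squareShapeCount-≡1)
    (trans (ℕₚ.*-comm (2 ^ k) 4) (sym (2^[2+n]≡4*2^n k)))

  shiftedSquareCount-≡5 : ∀ k {c} → c ≋ + 5 ⟨mod 8 ⟩ →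
                          shiftedSquareCount (2 ^ (4 ℕ.+ k)) {{2^≢0 (4 ℕ.+ k)}} c ≡ 2 ^ (2 ℕ.+ k)
  shiftedSquareCount-≡5 k {c} c≋5 = trans
    (shiftedSquareCount-nonSeven k {c} 5 4 c≋5 (from-yes (+ 5 ≋? + 1 ⟨mod 2 ⟩)) (from-no (+ 5 ≋? + 7 ⟨mod 8 ⟩))
                                 squareShapeCount-≡5)
    (trans (ℕₚ.*-comm (2 ^ k) 4) (sym (2^[2+n]≡4*2^n k)))

  shiftedSquareCount-≡3 : ∀ k {c} → c ≋ + 3 ⟨mod 8 ⟩ →
                          shiftedSquareCount (2 ^ (4 ℕ.+ k)) {{2^≢0 (4 ℕ.+ k)}} c ≡ 2 ^ (1 ℕ.+ k)
  shiftedSquareCount-≡3 k {c} c≋3 = trans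
    (shiftedSquareCount-nonSeven k {c} 3 2 c≋3 (from-yes (+ 3 ≋? + 1 ⟨mod 2 ⟩)) (from-no (+ 3 ≋? + 7 ⟨mod 8 ⟩))
                                 squareShapeCount-≡3)
    (ℕₚ.*-comm (2 ^ k) 2)

open PeriodicCase

module SevenCase where

  open import Data.Integer.Base using (_+_; _-_; _*_)

  pos-2*+1 : ∀ x → + suc (2 ℕ.* x) ≡ + 2 * + x + + 1
  pos-2*+1 x = trans (pos-+ 1 (2 ℕ.* x)) (trans (cong (λ z → + 1 + z) (pos-* 2 x)) (+-comm (+ 1) (+ 2 * + x)))

  pos-4* : ∀ y → + (2 ℕ.* (2 ℕ.* y)) ≡ + 4 * + y
  pos-4* y = trans (pos-* 2 (2 ℕ.* y)) (trans (cong (λ z → + 2 * z) (pos-* 2 y)) (sym (*-assoc (+ 2) (+ 2) (+ y))))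

  quadratic : ℤ → ℤ → ℤ → ℤ
  quadratic γ b u = u * (+ 4 * γ * u + b)

  quadraticSquareCount : ℕ → ℤ → ℤ → ℕ
  quadraticSquareCount T γ b = count (2 ^ T) (λ u → squareMod2^? T (quadratic γ b (+ u)))

  halfPowerCeil : ℕ → ℕ
  halfPowerCeil zero    = 1
  halfPowerCeil (suc T) = 2 ^ T

  φ : ℕ → ℕ
  φ 0             = 1
  φ 1             = 2
  φ (suc (suc T)) = φ T ℕ.+ halfPowerCeil T

  -- An even argument 4y reduces the modulus by 4, while 2 × odd is never a square.
  count-squares-of-evens : ∀ T (F G : ℤ → ℤ) →
    (∀ y → F (+ 4 * y) ≡ + 4 * G y) → (∀ y → F (+ 2 * (+ 2 * y + + 1)) ≋ + 2 ⟨mod 4 ⟩) →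
    count (2 ^ suc T) (λ x → squareMod2^? (2 ℕ.+ T) (F (+ (2 ℕ.* x)))) ≡
    count (2 ^ T) (λ y → squareMod2^? T (G (+ y)))
  count-squares-of-evens T F G F[4y] F[4y+2] = begin
    count (2 ^ suc T) P?
      ≡⟨ count-evens-odds (2 ^ T) P? ⟩
    count (2 ^ T) (λ y → P? (2 ℕ.* y)) ℕ.+ count (2 ^ T) (λ y → P? (suc (2 ℕ.* y)))
      ≡⟨ cong₂ ℕ._+_ (count-cong (2 ^ T) _ _ (λ y _ → at-4y y)) (count-none (2 ^ T) _ at-4y+2) ⟩
    count (2 ^ T) (λ y → squareMod2^? T (G (+ y))) ℕ.+ 0
      ≡⟨ ℕₚ.+-identityʳ _ ⟩
    count (2 ^ T) (λ y → squareMod2^? T (G (+ y))) ∎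
    where
    open ≡-Reasoning
    P? = λ x → squareMod2^? (2 ℕ.+ T) (F (+ (2 ℕ.* x)))
    at-4y : ∀ y → SquareMod (2 ^ (2 ℕ.+ T)) (F (+ (2 ℕ.* (2 ℕ.* y)))) ⇔ SquareMod (2 ^ T) (G (+ y))
    at-4y y = subst (λ z → SquareMod (2 ^ (2 ℕ.+ T)) z ⇔ SquareMod (2 ^ T) (G (+ y)))
                   (sym (trans (cong F (pos-4* y)) (F[4y] (+ y)))) (squareMod-4*⇔ T)
    at-4y+2 : ∀ y → ¬ SquareMod (2 ^ (2 ℕ.+ T)) (F (+ (2 ℕ.* suc (2 ℕ.* y))))
    at-4y+2 y = ¬squareMod-4 (inj₁ (subst (λ z → F z ≋ + 2 ⟨mod 4 ⟩) (sym two*odd) (F[4y+2] (+ y))))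
          ∘ squareMod-∣ (2^j∣2^[j+k] 2 T)
      where
      two*odd : + (2 ℕ.* suc (2 ℕ.* y)) ≡ + 2 * (+ 2 * + y + + 1)
      two*odd = trans (pos-* 2 (suc (2 ℕ.* y))) (cong (λ z → + 2 * z) (pos-2*+1 y))

  quadratic-odd : ∀ γ {b} x → b ≋ + 1 ⟨mod 2 ⟩ → quadratic γ b (+ 2 * x + + 1) ≋ + 1 ⟨mod 2 ⟩
  quadratic-odd γ x (≋-intro q refl) =
    ≋-intro (+ 2 * γ * (+ 2 * x + + 1) * (+ 2 * x + + 1) + x + q * (+ 2 * x + + 1)) (lemma γ q x)
    where
    lemma : ∀ γ q x → (+ 2 * x + + 1) * (+ 4 * γ * (+ 2 * x + + 1) + (+ 1 + q * + 2))
                    ≡ + 1 + (+ 2 * γ * (+ 2 * x + + 1) * (+ 2 * x + + 1) + x + q * (+ 2 * x + + 1)) * + 2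
    lemma = solve-∀

  quadratic-odd-cong₈ : ∀ {γ γ′ b b′ x x′} → γ ≋ γ′ ⟨mod 2 ⟩ → b ≋ b′ ⟨mod 8 ⟩ → x ≋ x′ ⟨mod 4 ⟩ →
    quadratic γ b (+ 2 * x + + 1) ≋ quadratic γ′ b′ (+ 2 * x′ + + 1) ⟨mod 8 ⟩
  quadratic-odd-cong₈ {x = x} {x′} γ≋γ′ b≋b′ x≋x′ = ≋-* u≋u′ (≋-+ (≋-* (≋-scale 4 γ≋γ′) u≋u′) b≋b′)
    where
    u≋u′ : + 2 * x + + 1 ≋ + 2 * x′ + + 1 ⟨mod 8 ⟩
    u≋u′ = ≋-+ (≋-scale 2 x≋x′) ≋-refl

  quadratic-odd-mod₄ : ∀ γ {b b′} x → b ≋ b′ ⟨mod 4 ⟩ →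
    quadratic γ b (+ 2 * x + + 1) ≋ quadratic (+ 0) b′ (+ 2 * x + + 1) ⟨mod 4 ⟩
  quadratic-odd-mod₄ γ x b≋b′ = ≋-* (≋-refl {u}) (≋-+ 4γu≋0 b≋b′)
    where
    u = + 2 * x + + 1
    lemma : ∀ γ u → + 4 * γ * u ≡ + 4 * + 0 * u + γ * u * + 4
    lemma = solve-∀
    4γu≋0 : + 4 * γ * u ≋ + 4 * + 0 * u ⟨mod 4 ⟩
    4γu≋0 = ≋-intro (γ * u) (lemma γ u)

  count-odd-quadratic-squares : ∀ T γ {b} → b ≋ + 1 ⟨mod 2 ⟩ →
    count (2 ^ suc T) (λ x → squareMod2^? (2 ℕ.+ T) (quadratic γ b (+ suc (2 ℕ.* x)))) ≡ halfPowerCeil T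
  count-odd-quadratic-squares zero γ {b} b-odd = trans
    (count-cong 2 (λ x → squareMod2^? 2 (quadratic γ b (+ suc (2 ℕ.* x))))
                  (λ x → quadratic (+ 0) (+ toℕ b₀) (+ 2 * + x + + 1) ≋? + 1 ⟨mod 4 ⟩) (λ x _ → odd⇔ x))
    (table b₀ b₀-odd)
    where
    b₀ : Fin 4
    b₀ = proj₁ (residue 4 b)
    b≋b₀ : b ≋ + toℕ b₀ ⟨mod 4 ⟩
    b≋b₀ = proj₂ (residue 4 b)
    b₀-odd : + toℕ b₀ ≋ + 1 ⟨mod 2 ⟩
    b₀-odd = ≋-trans (≋-sym (≋-∣ (divides 2 refl) b≋b₀)) b-odd
    table : ∀ (b : Fin 4) → + toℕ b ≋ + 1 ⟨mod 2 ⟩ →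
            count 2 (λ x → quadratic (+ 0) (+ toℕ b) (+ 2 * + x + + 1) ≋? + 1 ⟨mod 4 ⟩) ≡ 1
    table = from-yes (all? λ (b : Fin 4) → (+ toℕ b ≋? + 1 ⟨mod 2 ⟩) →-dec
      (count 2 (λ x → quadratic (+ 0) (+ toℕ b) (+ 2 * + x + + 1) ≋? + 1 ⟨mod 4 ⟩) ℕₚ.≟ 1))
    odd⇔ : ∀ x → SquareMod 4 (quadratic γ b (+ suc (2 ℕ.* x))) ⇔
                 quadratic (+ 0) (+ toℕ b₀) (+ 2 * + x + + 1) ≋ + 1 ⟨mod 4 ⟩
    odd⇔ x = subst (λ u → SquareMod 4 (quadratic γ b u) ⇔
                          quadratic (+ 0) (+ toℕ b₀) (+ 2 * + x + + 1) ≋ + 1 ⟨mod 4 ⟩)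
                   (sym (pos-2*+1 x)) (mk⇔
      (λ sq → ≋-trans (≋-sym (quadratic-odd-mod₄ γ (+ x) b≋b₀))
                      (odd-squareMod-4 (quadratic-odd γ (+ x) b-odd) sq))
      (λ ≋1 → + 1 , ≋-sym (≋-trans (quadratic-odd-mod₄ γ (+ x) b≋b₀) ≋1)))
  count-odd-quadratic-squares (suc T) γ {b} b-odd = begin
    count (2 ^ (2 ℕ.+ T)) (λ x → squareMod2^? (3 ℕ.+ T) (quadratic γ b (+ suc (2 ℕ.* x))))
      ≡⟨ count-cong (2 ^ (2 ℕ.+ T)) _ _ (λ x _ → odd⇔ x) ⟩
    count (2 ^ (2 ℕ.+ T)) Q?
      ≡⟨ cong (λ n → count n Q?) (trans (2^[2+n]≡4*2^n T) (ℕₚ.*-comm 4 (2 ^ T))) ⟩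
    count (2 ^ T ℕ.* 4) Q?
      ≡⟨ count-periodic (2 ^ T) 4 Q? (λ x →
           ≋1⇔ (quadratic-odd-cong₈ (≋-refl {γ}) (≋-refl {b}) (period x))) ⟩
    2 ^ T ℕ.* count 4 Q?
      ≡⟨ cong (λ c → 2 ^ T ℕ.* c) (count-cong 4 Q? Q₀? (λ x _ →
           ≋1⇔ (quadratic-odd-cong₈ γ≋γ₀ b≋b₀ (≋-refl {+ x})))) ⟩
    2 ^ T ℕ.* count 4 Q₀?
      ≡⟨ cong (λ c → 2 ^ T ℕ.* c) (table γ₀ b₀ b₀-odd) ⟩
    2 ^ T ℕ.* 1
      ≡⟨ ℕₚ.*-identityʳ (2 ^ T) ⟩
    2 ^ T ∎
    where
    open ≡-Reasoning
    Q? = λ (x : ℕ) → quadratic γ b (+ 2 * + x + + 1) ≋? + 1 ⟨mod 8 ⟩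
    γ₀ : Fin 2
    γ₀ = proj₁ (residue 2 γ)
    γ≋γ₀ : γ ≋ + toℕ γ₀ ⟨mod 2 ⟩
    γ≋γ₀ = proj₂ (residue 2 γ)
    b₀ : Fin 8
    b₀ = proj₁ (residue 8 b)
    b≋b₀ : b ≋ + toℕ b₀ ⟨mod 8 ⟩
    b≋b₀ = proj₂ (residue 8 b)
    b₀-odd : + toℕ b₀ ≋ + 1 ⟨mod 2 ⟩
    b₀-odd = ≋-trans (≋-sym (≋-∣ (divides 4 refl) b≋b₀)) b-odd
    Q₀? = λ (x : ℕ) → quadratic (+ toℕ γ₀) (+ toℕ b₀) (+ 2 * + x + + 1) ≋? + 1 ⟨mod 8 ⟩
    table : ∀ (g : Fin 2) (b : Fin 8) → + toℕ b ≋ + 1 ⟨mod 2 ⟩ →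
            count 4 (λ x → quadratic (+ toℕ g) (+ toℕ b) (+ 2 * + x + + 1) ≋? + 1 ⟨mod 8 ⟩) ≡ 1
    table = from-yes (all? λ (g : Fin 2) → all? λ (b : Fin 8) → (+ toℕ b ≋? + 1 ⟨mod 2 ⟩) →-dec
      (count 4 (λ x → quadratic (+ toℕ g) (+ toℕ b) (+ 2 * + x + + 1) ≋? + 1 ⟨mod 8 ⟩) ℕₚ.≟ 1))
    ≋1⇔ : ∀ {m m′} → m ≋ m′ ⟨mod 8 ⟩ → m ≋ + 1 ⟨mod 8 ⟩ ⇔ m′ ≋ + 1 ⟨mod 8 ⟩
    ≋1⇔ m≋m′ = mk⇔ (≋-trans (≋-sym m≋m′)) (≋-trans m≋m′)
    period : ∀ x → + (x ℕ.+ 4) ≋ + x ⟨mod 4 ⟩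
    period x = ≋-intro (+ 1) (pos-+ x 4)
    odd⇔ : ∀ x → SquareMod (2 ^ (3 ℕ.+ T)) (quadratic γ b (+ suc (2 ℕ.* x))) ⇔
                 quadratic γ b (+ 2 * + x + + 1) ≋ + 1 ⟨mod 8 ⟩
    odd⇔ x = subst (λ u → SquareMod (2 ^ (3 ℕ.+ T)) (quadratic γ b u) ⇔
                          quadratic γ b (+ 2 * + x + + 1) ≋ + 1 ⟨mod 8 ⟩)
                   (sym (pos-2*+1 x)) (mk⇔
      (odd-squareMod-8 (quadratic-odd γ (+ x) b-odd) ∘ squareMod-∣ (2^j∣2^[j+k] 3 T))
      (squareMod-≡1[mod8] T))

  quadratic-4y+2≋2 : ∀ γ {b} y → b ≋ + 1 ⟨mod 2 ⟩ → quadratic γ b (+ 2 * (+ 2 * y + + 1)) ≋ + 2 ⟨mod 4 ⟩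
  quadratic-4y+2≋2 γ y (≋-intro β refl) =
    ≋-intro (γ * (+ 4 * y + + 2) * (+ 4 * y + + 2) + y + + 2 * y * β + β) (lemma γ y β)
    where
    lemma : ∀ γ y β → + 2 * (+ 2 * y + + 1) * (+ 4 * γ * (+ 2 * (+ 2 * y + + 1)) + (+ 1 + β * + 2))
                    ≡ + 2 + (γ * (+ 4 * y + + 2) * (+ 4 * y + + 2) + y + + 2 * y * β + β) * + 4
    lemma = solve-∀

  product-4y+2≋2 : ∀ {d} y → d ≋ + 1 ⟨mod 2 ⟩ →
                   + 2 * (+ 2 * y + + 1) * (+ 2 * (+ 2 * y + + 1) + d) ≋ + 2 ⟨mod 4 ⟩
  product-4y+2≋2 y (≋-intro δ refl) = ≋-intro (+ 4 * y * y + + 5 * y + + 2 * y * δ + δ + + 1) (lemma y δ)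
    where
    lemma : ∀ y δ → + 2 * (+ 2 * y + + 1) * (+ 2 * (+ 2 * y + + 1) + (+ 1 + δ * + 2))
                  ≡ + 2 + (+ 4 * y * y + + 5 * y + + 2 * y * δ + δ + + 1) * + 4
    lemma = solve-∀

  quadraticSquareCount≡φ : ∀ T γ {b} → b ≋ + 1 ⟨mod 2 ⟩ → quadraticSquareCount T γ b ≡ φ T
  quadraticSquareCount≡φ zero          γ {b} b-odd =
    count-all 1 (λ u → squareMod2^? 0 (quadratic γ b (+ u))) (λ u → squareMod-1 _)
  quadraticSquareCount≡φ (suc zero)    γ {b} b-odd =
    count-all 2 (λ u → squareMod2^? 1 (quadratic γ b (+ u))) (λ u → squareMod-2 _)
  quadraticSquareCount≡φ (suc (suc T)) γ {b} b-odd = begin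
    count (2 ^ (2 ℕ.+ T)) P?
      ≡⟨ count-evens-odds (2 ^ suc T) P? ⟩
    count (2 ^ suc T) (λ x → P? (2 ℕ.* x)) ℕ.+ count (2 ^ suc T) (λ x → P? (suc (2 ℕ.* x)))
      ≡⟨ cong₂ ℕ._+_ (count-squares-of-evens T (quadratic γ b) (quadratic (+ 4 * γ) b)
                                             quadratic-4y quadratic-4y+2)
                     (count-odd-quadratic-squares T γ {b} b-odd) ⟩
    quadraticSquareCount T (+ 4 * γ) b ℕ.+ halfPowerCeil T
      ≡⟨ cong (ℕ._+ halfPowerCeil T) (quadraticSquareCount≡φ T (+ 4 * γ) {b} b-odd) ⟩
    φ T ℕ.+ halfPowerCeil T ∎
    where
    open ≡-Reasoning
    P? = λ u → squareMod2^? (2 ℕ.+ T) (quadratic γ b (+ u))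
    quadratic-4y : ∀ y → quadratic γ b (+ 4 * y) ≡ + 4 * quadratic (+ 4 * γ) b y
    quadratic-4y y = lemma γ b y
      where
      lemma : ∀ γ b y → + 4 * y * (+ 4 * γ * (+ 4 * y) + b) ≡ + 4 * (y * (+ 4 * (+ 4 * γ) * y + b))
      lemma = solve-∀
    quadratic-4y+2 : ∀ y → quadratic γ b (+ 2 * (+ 2 * y + + 1)) ≋ + 2 ⟨mod 4 ⟩
    quadratic-4y+2 y = quadratic-4y+2≋2 γ y b-odd

  count-even-shiftedProducts : ∀ T {d} → d ≋ + 1 ⟨mod 2 ⟩ →
    count (2 ^ suc T) (λ x → squareMod2^? (2 ℕ.+ T) (+ (2 ℕ.* x) * (+ (2 ℕ.* x) + d))) ≡ φ T
  count-even-shiftedProducts T {d} d-odd =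
    trans (count-squares-of-evens T (λ w → w * (w + d)) (quadratic (+ 1) d) product-4y product-4y+2)
          (quadraticSquareCount≡φ T (+ 1) {d} d-odd)
    where
    product-4y : ∀ y → + 4 * y * (+ 4 * y + d) ≡ + 4 * quadratic (+ 1) d y
    product-4y y = lemma y d
      where
      lemma : ∀ y d → + 4 * y * (+ 4 * y + d) ≡ + 4 * (y * (+ 4 * + 1 * y + d))
      lemma = solve-∀
    product-4y+2 : ∀ y → + 2 * (+ 2 * y + + 1) * (+ 2 * (+ 2 * y + + 1) + d) ≋ + 2 ⟨mod 4 ⟩
    product-4y+2 y = product-4y+2≋2 y d-odd

  -- Since b + 1 is even, the odd w = 2y + 1 give w (w + b) = 2y′ (2y′ - b) with y′ = y + (b + 1) / 2.
  count-shiftedProducts : ∀ T β {b} → b ≡ + 2 * + β + + 1 →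
    count (2 ^ (2 ℕ.+ T)) (λ w → squareMod2^? (2 ℕ.+ T) (+ w * (+ w + b))) ≡ φ T ℕ.+ φ T
  count-shiftedProducts T β {b} b≡2β+1 = begin
    count (2 ^ (2 ℕ.+ T)) P?
      ≡⟨ count-evens-odds N P? ⟩
    count N (λ x → P? (2 ℕ.* x)) ℕ.+ count N (λ x → P? (suc (2 ℕ.* x)))
      ≡⟨ cong (count N (λ x → P? (2 ℕ.* x)) ℕ.+_)
              (count-cong N (λ x → P? (suc (2 ℕ.* x))) (λ y → E? (y ℕ.+ suc β))
                          (λ y _ → odd≡shifted-even y)) ⟩
    count N (λ x → P? (2 ℕ.* x)) ℕ.+ count N (λ y → E? (y ℕ.+ suc β))
      ≡⟨ cong₂ ℕ._+_ (count-even-shiftedProducts T {b} b-odd) (count-rotate N (suc β) E? period) ⟩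
    φ T ℕ.+ count N E?
      ≡⟨ cong (φ T ℕ.+_) (count-even-shiftedProducts T { - b} -b-odd) ⟩
    φ T ℕ.+ φ T ∎
    where
    open ≡-Reasoning
    N = 2 ^ suc T
    P? = λ w → squareMod2^? (2 ℕ.+ T) (+ w * (+ w + b))
    E? = λ y → squareMod2^? (2 ℕ.+ T) (+ (2 ℕ.* y) * (+ (2 ℕ.* y) + - b))
    b-odd : b ≋ + 1 ⟨mod 2 ⟩
    b-odd = ≋-intro (+ β) (trans b≡2β+1 (lemma (+ β)))
      where
      lemma : ∀ β → + 2 * β + + 1 ≡ + 1 + β * + 2
      lemma = solve-∀
    -b-odd : - b ≋ + 1 ⟨mod 2 ⟩
    -b-odd = ≋-intro (- + β - + 1) (trans (cong -_ b≡2β+1) (lemma (+ β)))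
      where
      lemma : ∀ β → - (+ 2 * β + + 1) ≡ + 1 + (- β - + 1) * + 2
      lemma = solve-∀
    odd≡shifted-even : ∀ y → SquareMod (2 ℕ.* N) (+ suc (2 ℕ.* y) * (+ suc (2 ℕ.* y) + b)) ⇔
                             SquareMod (2 ℕ.* N) (+ (2 ℕ.* (y ℕ.+ suc β)) * (+ (2 ℕ.* (y ℕ.+ suc β)) + - b))
    odd≡shifted-even y = mk⇔ (squareMod-resp (≋-reflexive same)) (squareMod-resp (≋-reflexive (sym same)))
      where
      lemma : ∀ y β → (+ 2 * y + + 1) * (+ 2 * y + + 1 + (+ 2 * β + + 1))
                    ≡ + 2 * (y + (+ 1 + β)) * (+ 2 * (y + (+ 1 + β)) + - (+ 2 * β + + 1))
      lemma = solve-∀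
      pos-y+1+β : + (y ℕ.+ suc β) ≡ + y + (+ 1 + + β)
      pos-y+1+β = trans (pos-+ y (suc β)) (cong (λ z → + y + z) (pos-+ 1 β))
      same : + suc (2 ℕ.* y) * (+ suc (2 ℕ.* y) + b) ≡
             + (2 ℕ.* (y ℕ.+ suc β)) * (+ (2 ℕ.* (y ℕ.+ suc β)) + - b)
      same = begin
        + suc (2 ℕ.* y) * (+ suc (2 ℕ.* y) + b)
          ≡⟨ cong₂ (λ u b → u * (u + b)) (pos-2*+1 y) b≡2β+1 ⟩
        (+ 2 * + y + + 1) * (+ 2 * + y + + 1 + (+ 2 * + β + + 1))
          ≡⟨ lemma (+ y) (+ β) ⟩
        + 2 * (+ y + (+ 1 + + β)) * (+ 2 * (+ y + (+ 1 + + β)) + - (+ 2 * + β + + 1))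
          ≡⟨ cong₂ (λ u b → u * (u + - b)) (trans (pos-* 2 (y ℕ.+ suc β)) (cong (λ z → + 2 * z) pos-y+1+β))
                   b≡2β+1 ⟨
        + (2 ℕ.* (y ℕ.+ suc β)) * (+ (2 ℕ.* (y ℕ.+ suc β)) + - b) ∎
    period : ∀ y → SquareMod (2 ℕ.* N) (+ (2 ℕ.* (y ℕ.+ N)) * (+ (2 ℕ.* (y ℕ.+ N)) + - b)) ⇔
                   SquareMod (2 ℕ.* N) (+ (2 ℕ.* y) * (+ (2 ℕ.* y) + - b))
    period y = mk⇔ (squareMod-resp shift) (squareMod-resp (≋-sym shift))
      where
      lemma : ∀ y N b → + 2 * (y + N) * (+ 2 * (y + N) + - b)
                      ≡ + 2 * y * (+ 2 * y + - b) + (+ 4 * y - b + + 2 * N) * (+ 2 * N)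
      lemma = solve-∀
      q = + 4 * + y - b + + 2 * + N
      shift : + (2 ℕ.* (y ℕ.+ N)) * (+ (2 ℕ.* (y ℕ.+ N)) + - b) ≋
              + (2 ℕ.* y) * (+ (2 ℕ.* y) + - b) ⟨mod 2 ℕ.* N ⟩
      shift = ≋-intro q (begin
        + (2 ℕ.* (y ℕ.+ N)) * (+ (2 ℕ.* (y ℕ.+ N)) + - b)
          ≡⟨ cong (λ u → u * (u + - b)) (trans (pos-* 2 (y ℕ.+ N)) (cong (λ z → + 2 * z) (pos-+ y N))) ⟩
        + 2 * (+ y + + N) * (+ 2 * (+ y + + N) + - b)
          ≡⟨ lemma (+ y) (+ N) b ⟩
        + 2 * + y * (+ 2 * + y + - b) + q * (+ 2 * + N)
          ≡⟨ cong₂ (λ u v → u * (u + - b) + q * v) (pos-* 2 y) (pos-* 2 N) ⟨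
        + (2 ℕ.* y) * (+ (2 ℕ.* y) + - b) + q * + (2 ℕ.* N) ∎)

  odd-root-of-negation : ∀ k {c} → c ≋ + 7 ⟨mod 8 ⟩ →
    ∃ λ β → c + (+ 2 * + β + + 1) * (+ 2 * + β + + 1) ≋ + 0 ⟨mod 2 ^ (5 ℕ.+ k) ⟩
  odd-root-of-negation k {c} c≋7 =
    let σ , root = odd-squareRoot (2 ℕ.+ k) (≋-trans (≋-neg c≋7) (from-yes (- + 7 ≋? + 1 ⟨mod 8 ⟩)))
    in reduce σ root
    where
    reduce : ∀ σ → (+ 2 * σ + + 1) * (+ 2 * σ + + 1) ≋ - c ⟨mod 2 ^ (5 ℕ.+ k) ⟩ →
             ∃ λ β → c + (+ 2 * + β + + 1) * (+ 2 * + β + + 1) ≋ + 0 ⟨mod 2 ^ (5 ℕ.+ k) ⟩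
    reduce σ root with residue (2 ^ (4 ℕ.+ k)) {{2^≢0 (4 ℕ.+ k)}} σ
    ... | β , σ≋β = toℕ β ,
      ≋-trans (≋-+ (≋-refl {c}) (≋-trans (≋-sym (≋-* b≋ b≋)) root)) (≋-reflexive (+-inverseʳ c))
      where
      b≋ : + 2 * σ + + 1 ≋ + 2 * + toℕ β + + 1 ⟨mod 2 ^ (5 ℕ.+ k) ⟩
      b≋ = ≋-+ (≋-scale 2 σ≋β) (≋-refl {+ 1})

  -- Writing the odd e as 2w + b, where c + b² ≡ 0, turns c + e² into 4 w (w + b).
  shiftedSquareCount-via-root : ∀ k {c} β → c ≋ + 7 ⟨mod 8 ⟩ →
    c + (+ 2 * + β + + 1) * (+ 2 * + β + + 1) ≋ + 0 ⟨mod 2 ^ (5 ℕ.+ k) ⟩ →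
    shiftedSquareCount (2 ^ (4 ℕ.+ k)) {{2^≢0 (4 ℕ.+ k)}} c ≡ φ (suc k) ℕ.+ φ (suc k)
  shiftedSquareCount-via-root k {c} β c≋7 root = begin
    count (2 ^ (4 ℕ.+ k)) F?
      ≡⟨ count-evens-odds N F? ⟩
    count N (λ f → F? (2 ℕ.* f)) ℕ.+ count N Q?
      ≡⟨ cong₂ ℕ._+_ (count-none N _ even-¬square) (sym (count-rotate N β Q? period)) ⟩
    count N (λ w → Q? (w ℕ.+ β))
      ≡⟨ count-cong N _ (λ w → squareMod2^? (3 ℕ.+ k) (+ w * (+ w + (+ 2 * + β + + 1))))
                        (λ w _ → shifted w) ⟩
    count N (λ w → squareMod2^? (3 ℕ.+ k) (+ w * (+ w + (+ 2 * + β + + 1))))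
      ≡⟨ count-shiftedProducts (suc k) β {+ 2 * + β + + 1} refl ⟩
    φ (suc k) ℕ.+ φ (suc k) ∎
    where
    open ≡-Reasoning
    N = 2 ^ (3 ℕ.+ k)
    F? = λ e → squareMod2^? (5 ℕ.+ k) (c + + e * + e)
    Q? = λ f → F? (suc (2 ℕ.* f))
    pos-4N : + (2 ^ (5 ℕ.+ k)) ≡ + 4 * + N
    pos-4N = pos-2^-+ 2 (3 ℕ.+ k)
    even-¬square : ∀ f → ¬ SquareMod (2 ^ (5 ℕ.+ k)) (c + + (2 ℕ.* f) * + (2 ℕ.* f))
    even-¬square f = ¬squareMod-4 (inj₂ (≡3 c≋7)) ∘ squareMod-∣ (2^j∣2^[j+k] 2 (3 ℕ.+ k))
      where
      lemma : ∀ q f → + 7 + q * + 8 + + 2 * f * (+ 2 * f) ≡ + 3 + (+ 1 + + 2 * q + f * f) * + 4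
      lemma = solve-∀
      ≡3 : ∀ {c} → c ≋ + 7 ⟨mod 8 ⟩ → c + + (2 ℕ.* f) * + (2 ℕ.* f) ≋ + 3 ⟨mod 4 ⟩
      ≡3 (≋-intro q refl) = ≋-intro (+ 1 + + 2 * q + + f * + f)
        (trans (cong (λ z → + 7 + q * + 8 + z * z) (pos-* 2 f)) (lemma q (+ f)))
    period : ∀ f → SquareMod (2 ^ (5 ℕ.+ k)) (c + + suc (2 ℕ.* (f ℕ.+ N)) * + suc (2 ℕ.* (f ℕ.+ N))) ⇔
                   SquareMod (2 ^ (5 ℕ.+ k)) (c + + suc (2 ℕ.* f) * + suc (2 ℕ.* f))
    period f = mk⇔ (squareMod-resp shift) (squareMod-resp (≋-sym shift))
      where
      lemma : ∀ c f N → c + (+ 2 * (f + N) + + 1) * (+ 2 * (f + N) + + 1)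
                      ≡ c + (+ 2 * f + + 1) * (+ 2 * f + + 1) + (+ 2 * f + + 1 + N) * (+ 4 * N)
      lemma = solve-∀
      shift : c + + suc (2 ℕ.* (f ℕ.+ N)) * + suc (2 ℕ.* (f ℕ.+ N)) ≋
              c + + suc (2 ℕ.* f) * + suc (2 ℕ.* f) ⟨mod 2 ^ (5 ℕ.+ k) ⟩
      shift = ≋-intro (+ 2 * + f + + 1 + + N) (begin
        c + + suc (2 ℕ.* (f ℕ.+ N)) * + suc (2 ℕ.* (f ℕ.+ N))
          ≡⟨ cong (λ u → c + u * u) (trans (pos-2*+1 (f ℕ.+ N)) (cong (λ z → + 2 * z + + 1) (pos-+ f N))) ⟩
        c + (+ 2 * (+ f + + N) + + 1) * (+ 2 * (+ f + + N) + + 1)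
          ≡⟨ lemma c (+ f) (+ N) ⟩
        c + (+ 2 * + f + + 1) * (+ 2 * + f + + 1) + (+ 2 * + f + + 1 + + N) * (+ 4 * + N)
          ≡⟨ cong₂ (λ u v → c + u * u + (+ 2 * + f + + 1 + + N) * v) (pos-2*+1 f) pos-4N ⟨
        c + + suc (2 ℕ.* f) * + suc (2 ℕ.* f) + (+ 2 * + f + + 1 + + N) * + (2 ^ (5 ℕ.+ k)) ∎)
    shifted : ∀ w → SquareMod (2 ^ (5 ℕ.+ k)) (c + + suc (2 ℕ.* (w ℕ.+ β)) * + suc (2 ℕ.* (w ℕ.+ β))) ⇔
                    SquareMod (2 ^ (3 ℕ.+ k)) (+ w * (+ w + (+ 2 * + β + + 1)))
    shifted w = squareMod-4*⇔ (3 ℕ.+ k) ⇔-∘ mk⇔ (squareMod-resp shift) (squareMod-resp (≋-sym shift))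
      where
      lemma : ∀ c w β → c + (+ 2 * (w + β) + + 1) * (+ 2 * (w + β) + + 1)
                      ≡ c + (+ 2 * β + + 1) * (+ 2 * β + + 1) + + 4 * (w * (w + (+ 2 * β + + 1)))
      lemma = solve-∀
      4w[w+b] = + 4 * (+ w * (+ w + (+ 2 * + β + + 1)))
      pos-2[w+β]+1 : + suc (2 ℕ.* (w ℕ.+ β)) ≡ + 2 * (+ w + + β) + + 1
      pos-2[w+β]+1 = trans (pos-2*+1 (w ℕ.+ β)) (cong (λ z → + 2 * z + + 1) (pos-+ w β))
      shift : c + + suc (2 ℕ.* (w ℕ.+ β)) * + suc (2 ℕ.* (w ℕ.+ β)) ≋ 4w[w+b] ⟨mod 2 ^ (5 ℕ.+ k) ⟩
      shift = ≋-trans (≋-reflexive (trans (cong (λ u → c + u * u) pos-2[w+β]+1) (lemma c (+ w) (+ β))))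
                      (≋-trans (≋-+ root (≋-refl {4w[w+b]})) (≋-reflexive (+-identityˡ 4w[w+b])))

  shiftedSquareCount-seven : ∀ k {c} → c ≋ + 7 ⟨mod 8 ⟩ →
    shiftedSquareCount (2 ^ (4 ℕ.+ k)) {{2^≢0 (4 ℕ.+ k)}} c ≡ φ (suc k) ℕ.+ φ (suc k)
  shiftedSquareCount-seven k {c} c≋7 =
    let β , root = odd-root-of-negation k c≋7 in shiftedSquareCount-via-root k {c} β c≋7 root

  φ-closed-form : ∀ k → + (3 ℕ.* (φ (suc k) ℕ.+ φ (suc k))) ≡ + (2 ^ suc k) + (- + 1) ℤ.^ (4 ℕ.+ k) + + 9
  φ-closed-form zero          = refl
  φ-closed-form (suc zero)    = refl
  φ-closed-form (suc (suc k)) = begin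
    + (3 ℕ.* (φ (suc k) ℕ.+ 2 ^ k ℕ.+ (φ (suc k) ℕ.+ 2 ^ k)))
      ≡⟨ pos-3[x+x] (φ (suc k) ℕ.+ 2 ^ k) ⟩
    + 3 * (+ (φ (suc k) ℕ.+ 2 ^ k) + + (φ (suc k) ℕ.+ 2 ^ k))
      ≡⟨ cong (λ z → + 3 * (z + z)) (pos-+ (φ (suc k)) (2 ^ k)) ⟩
    + 3 * (+ φ (suc k) + P + (+ φ (suc k) + P))
      ≡⟨ split (+ φ (suc k)) P ⟩
    + 3 * (+ φ (suc k) + + φ (suc k)) + + 6 * P
      ≡⟨ cong (λ z → z + + 6 * P) (trans (sym (pos-3[x+x] (φ (suc k)))) (φ-closed-form k)) ⟩
    + (2 ^ suc k) + S + + 9 + + 6 * P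
      ≡⟨ cong (λ z → z + S + + 9 + + 6 * P) (pos-* 2 (2 ^ k)) ⟩
    + 2 * P + S + + 9 + + 6 * P
      ≡⟨ collect P S ⟩
    + 8 * P + - + 1 * (- + 1 * S) + + 9
      ≡⟨ cong (λ z → z + - + 1 * (- + 1 * S) + + 9) (pos-2^-+ 3 k) ⟨
    + (2 ^ (3 ℕ.+ k)) + - + 1 * (- + 1 * S) + + 9 ∎
    where
    open ≡-Reasoning
    P = + (2 ^ k)
    S = (- + 1) ℤ.^ (4 ℕ.+ k)
    pos-3[x+x] : ∀ x → + (3 ℕ.* (x ℕ.+ x)) ≡ + 3 * (+ x + + x)
    pos-3[x+x] x = trans (pos-* 3 (x ℕ.+ x)) (cong (λ z → + 3 * z) (pos-+ x x))
    split : ∀ F P → + 3 * (F + P + (F + P)) ≡ + 3 * (F + F) + + 6 * P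
    split = solve-∀
    collect : ∀ P S → + 2 * P + S + + 9 + + 6 * P ≡ + 8 * P + - + 1 * (- + 1 * S) + + 9
    collect = solve-∀

  shiftedSquareCount-≡7 : ∀ k {c} → c ≋ + 7 ⟨mod 8 ⟩ →
    + (3 ℕ.* shiftedSquareCount (2 ^ (4 ℕ.+ k)) {{2^≢0 (4 ℕ.+ k)}} c) ≡
    + (2 ^ suc k) + (- + 1) ℤ.^ (4 ℕ.+ k) + + 9
  shiftedSquareCount-≡7 k {c} c≋7 =
    trans (cong (λ n → + (3 ℕ.* n)) (shiftedSquareCount-seven k {c} c≋7)) (φ-closed-form k)

open SevenCase

module SmallModuli where

  open import Data.Integer.Base using (_+_)

  shiftedSquareCount-1 : ∀ {c} → c ≋ + 1 ⟨mod 2 ⟩ → shiftedSquareCount 1 c ≡ 1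
  shiftedSquareCount-1 {c} = shiftedSquareCount-by-residue 1 (divides 1 refl) (from-yes (all? λ (r : Fin 2) →
    (+ toℕ r ≋? + 1 ⟨mod 2 ⟩) →-dec (shiftedSquareCount 1 (+ toℕ r) ℕₚ.≟ 1))) c

  shiftedSquareCount-2 : ∀ {c} → c ≋ + 1 ⟨mod 2 ⟩ → shiftedSquareCount 2 c ≡ 1
  shiftedSquareCount-2 {c} = shiftedSquareCount-by-residue 2 (divides 2 refl) (from-yes (all? λ (r : Fin 4) →
    (+ toℕ r ≋? + 1 ⟨mod 2 ⟩) →-dec (shiftedSquareCount 2 (+ toℕ r) ℕₚ.≟ 1))) c

  shiftedSquareCount-4-≡1 : ∀ {c} → c ≋ + 1 ⟨mod 4 ⟩ → shiftedSquareCount 4 c ≡ 1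
  shiftedSquareCount-4-≡1 {c} = shiftedSquareCount-by-residue 4 (divides 2 refl) (from-yes (all? λ (r : Fin 8) →
    (+ toℕ r ≋? + 1 ⟨mod 4 ⟩) →-dec (shiftedSquareCount 4 (+ toℕ r) ℕₚ.≟ 1))) c

  shiftedSquareCount-4-≡3 : ∀ {c} → c ≋ + 3 ⟨mod 4 ⟩ → shiftedSquareCount 4 c ≡ 2
  shiftedSquareCount-4-≡3 {c} = shiftedSquareCount-by-residue 4 (divides 2 refl) (from-yes (all? λ (r : Fin 8) →
    (+ toℕ r ≋? + 3 ⟨mod 4 ⟩) →-dec (shiftedSquareCount 4 (+ toℕ r) ℕₚ.≟ 2))) c

  shiftedSquareCount-8 : ∀ {c} → c ≋ + 1 ⟨mod 2 ⟩ → shiftedSquareCount 8 c ≡ 2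
  shiftedSquareCount-8 {c} = shiftedSquareCount-by-residue 8 (divides 8 refl) (from-yes (all? λ (r : Fin 16) →
    (+ toℕ r ≋? + 1 ⟨mod 2 ⟩) →-dec (shiftedSquareCount 8 (+ toℕ r) ℕₚ.≟ 2))) c

open SmallModuli

open import Data.Nat.Base using (_*_)

theorem3p3 : (a : ℤ) → a ≡ (+ 1) [mod 2 ] →
  ((t : ℕ) → 5 ≤ t →
    ((a ≡ (+ 7) [mod 8 ] → ∃ λ k → HasCard (InD̄₂ a (2 ^ t)) k
        × (+ (3 * k)) ≡ (+ (2 ^ (t ∸ 4))) ℤ.+ ((- (+ 1)) ℤ.^ (t ∸ 1)) ℤ.+ (+ 9))
    × (a ≡ (+ 1) [mod 8 ] → HasCard (InD̄₂ a (2 ^ t)) (2 ^ (t ∸ 3)))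
    × (a ≡ (+ 5) [mod 8 ] → HasCard (InD̄₂ a (2 ^ t)) (2 ^ (t ∸ 3)))
    × (a ≡ (+ 3) [mod 8 ] → HasCard (InD̄₂ a (2 ^ t)) (2 ^ (t ∸ 4))))
    × ((a ≡ (+ 1) [mod 8 ] → ∃ λ k → HasCard (InS̄₂ a (2 ^ t)) k
        × (+ (3 * k)) ≡ (+ (2 ^ (t ∸ 4))) ℤ.+ ((- (+ 1)) ℤ.^ (t ∸ 1)) ℤ.+ (+ 9))
    × (a ≡ (+ 3) [mod 8 ] → HasCard (InS̄₂ a (2 ^ t)) (2 ^ (t ∸ 3)))
    × (a ≡ (+ 7) [mod 8 ] → HasCard (InS̄₂ a (2 ^ t)) (2 ^ (t ∸ 3)))
    × (a ≡ (+ 5) [mod 8 ] → HasCard (InS̄₂ a (2 ^ t)) (2 ^ (t ∸ 4)))))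
  × HasCard (InS̄₂ a 16) 2
  × HasCard (InS̄₂ a 2) 1
  × HasCard (InS̄₂ a 4) 1
  × (a ≡ (+ 1) [mod 4 ] → HasCard (InS̄₂ a 8) 2)
  × (a ≡ (+ 3) [mod 4 ] → HasCard (InS̄₂ a 8) 1)
theorem3p3 a a-odd =
  (λ { _ (s≤s (s≤s (s≤s (s≤s (s≤s {n = k} _))))) →
      ( (λ a≡7 → _ , D̄ k , shiftedSquareCount-≡7 k {a} (≡[mod]⇒≋ a≡7))
      , (λ a≡1 → D̄-card k (shiftedSquareCount-≡1 k {a} (≡[mod]⇒≋ a≡1)))
      , (λ a≡5 → D̄-card k (shiftedSquareCount-≡5 k {a} (≡[mod]⇒≋ a≡5)))
      , (λ a≡3 → D̄-card k (shiftedSquareCount-≡3 k {a} (≡[mod]⇒≋ a≡3))) )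
    , ( (λ a≡1 → _ , S̄ k , shiftedSquareCount-≡7 k { - a} (negated a≡1 (from-yes (- + 1 ≋? + 7 ⟨mod 8 ⟩))))
      , (λ a≡3 → S̄-card k (shiftedSquareCount-≡5 k { - a} (negated a≡3 (from-yes (- + 3 ≋? + 5 ⟨mod 8 ⟩)))))
      , (λ a≡7 → S̄-card k (shiftedSquareCount-≡1 k { - a} (negated a≡7 (from-yes (- + 7 ≋? + 1 ⟨mod 8 ⟩)))))
      , (λ a≡5 → S̄-card k (shiftedSquareCount-≡3 k { - a} (negated a≡5 (from-yes (- + 5 ≋? + 3 ⟨mod 8 ⟩))))) ) })
  , subst (HasCard _) (shiftedSquareCount-8 { - a} -a-odd) (card-S̄₂ 8 a-odd′)
  , subst (HasCard _) (shiftedSquareCount-1 { - a} -a-odd) (card-S̄₂ 1 a-odd′)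
  , subst (HasCard _) (shiftedSquareCount-2 { - a} -a-odd) (card-S̄₂ 2 a-odd′)
  , (λ a≡1 → subst (HasCard _) (shiftedSquareCount-4-≡3 { - a} (negated a≡1 (from-yes (- + 1 ≋? + 3 ⟨mod 4 ⟩))))
                                (card-S̄₂ 4 a-odd′))
  , (λ a≡3 → subst (HasCard _) (shiftedSquareCount-4-≡1 { - a} (negated a≡3 (from-yes (- + 3 ≋? + 1 ⟨mod 4 ⟩))))
                                (card-S̄₂ 4 a-odd′))
  where
  a-odd′ : a ≋ + 1 ⟨mod 2 ⟩
  a-odd′ = ≡[mod]⇒≋ a-odd
  -a-odd : - a ≋ + 1 ⟨mod 2 ⟩
  -a-odd = ≋-trans (≋-neg a-odd′) (from-yes (- + 1 ≋? + 1 ⟨mod 2 ⟩))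
  negated : ∀ {n i j} → a ≡ + i [mod n ] → - + i ≋ + j ⟨mod n ⟩ → - a ≋ + j ⟨mod n ⟩
  negated a≡i -i≋j = ≋-trans (≋-neg (≡[mod]⇒≋ a≡i)) -i≋j
  D̄ : ∀ k → HasCard (InD̄₂ a (2 ^ (5 ℕ.+ k))) (shiftedSquareCount (2 ^ (4 ℕ.+ k)) {{2^≢0 (4 ℕ.+ k)}} a)
  D̄ k = card-D̄₂ (2 ^ (4 ℕ.+ k)) {{2^≢0 (4 ℕ.+ k)}} a-odd′
  S̄ : ∀ k → HasCard (InS̄₂ a (2 ^ (5 ℕ.+ k))) (shiftedSquareCount (2 ^ (4 ℕ.+ k)) {{2^≢0 (4 ℕ.+ k)}} (- a))
  S̄ k = card-S̄₂ (2 ^ (4 ℕ.+ k)) {{2^≢0 (4 ℕ.+ k)}} a-odd′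
  D̄-card : ∀ k {E} → shiftedSquareCount (2 ^ (4 ℕ.+ k)) {{2^≢0 (4 ℕ.+ k)}} a ≡ E →
           HasCard (InD̄₂ a (2 ^ (5 ℕ.+ k))) E
  D̄-card k eq = subst (HasCard _) eq (D̄ k)
  S̄-card : ∀ k {E} → shiftedSquareCount (2 ^ (4 ℕ.+ k)) {{2^≢0 (4 ℕ.+ k)}} (- a) ≡ E →
           HasCard (InS̄₂ a (2 ^ (5 ℕ.+ k))) E
  S̄-card k eq = subst (HasCard _) eq (S̄ k)
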